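{- Let $\mathcal G$ be a graph with distinct edges $e$ and $f$. Then $$\Phi G\{e\}=\Phi G^f\{e\}+y_f\,\Psi G\{e|f\}+y_f^2\,\Phi G_f\{e\},\qquad\text{where }\ \Psi G\{e|f\}=G^e_fG^f_e+G^{ef}G_{ef}-2G^f_eG_{ef}.$$ Moreover, if $\mathcal G=\mathcal H\oplus_g\mathcal K$ and $e\in E(\mathcal H)\setminus\{g\}$, then $\Phi G\{e\}=(K_g)^2\,\Phi H\{e\}$, where on the right-hand side the variable $y_g$ in $\Phi H\{e\}$ is set to $y_g:=K^g/K_g-1$.
   Context: For a graph with edge set $E$ and indeterminates $\mathbf y=(y_h:h\in E)$, its spanning forest polynomial is $\sum_X\mathbf y^X$ over acyclic $X\subseteq E$, $\mathbf y^X=\prod_{x\in X}y_x$; $G,H,K$ are those of $\mathcal G,\mathcal H,\mathcal K$. Subscripts denote partial derivatives ($G_f=\partial G/\partial y_f$, $G_{ef}=\partial^2G/\partial y_e\partial y_f$) and superscripts denote evaluation at zero ($G^f=G|_{y_f=0}$, $G^{ef}=G|_{y_e=y_f=0}$); mixed notation combines both, e.g. $G^f_e=(\partial G/\partial y_e)|_{y_f=0}$. For a polynomial $P$ obtained this way (e.g. $P=G$, $G^f$, $G_f$) define $\Phi P\{e\}=(P^e-P_e)P_e$. Two-sum: if $\mathcal H$ and $\mathcal K$ have exactly one edge $g$ in common, $\mathcal H\oplus_g\mathcal K$ is obtained by identifying the two copies of $g$ (endpoints identified in either of the two possible ways) and deleting $g$. -}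

module Defs where

open import Data.Bool using (Bool; true; false; if_then_else_)
open import Data.Nat using (ℕ; zero; suc; _+_)
open import Data.Fin using (Fin; zero; suc; punchIn; splitAt; _↑ˡ_; _↑ʳ_; _≟_)
open import Data.Fin.Subset using (Subset; _∈_)
open import Data.Vec using (Vec; []; _∷_; lookup; _[_]≔_)
open import Data.List using (List; []; _∷_; _++_; map; foldr)
open import Data.Product using (_×_; _,_; proj₁; proj₂)
open import Data.Sum using (_⊎_; inj₁; inj₂)
open import Data.Rational using (ℚ; 0ℚ; 1ℚ) renaming (_+_ to _+ℚ_; _*_ to _*ℚ_; _-_ to _-ℚ_)
open import Function.Definitions using (Injective)
open import Relation.Binary.PropositionalEquality using (_≡_)
open import Relation.Nullary using (¬_; Dec; yes; no)

-- Graphs: finite multigraphs (parallel edges and loops allowed) with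
-- edge set Fin m; each edge has an (unordered) pair of endpoints.

record Graph (m : ℕ) : Set where
  field
    V    : ℕ
    ends : Fin m → Fin V × Fin V

open Graph public

-- cyclic successor on Fin (suc k): 0 ↦ 1 ↦ … ↦ k ↦ 0
next : ∀ {k} → Fin (suc k) → Fin (suc k)
next {zero}  _       = zero
next {suc k} zero    = suc zero
next {suc k} (suc i) with next {k} i
... | zero  = zero
... | suc j = suc (suc j)

Joins : ∀ {m} (Γ : Graph m) → Fin m → Fin (V Γ) → Fin (V Γ) → Set
Joins Γ h u v = (ends Γ h ≡ (u , v)) ⊎ (ends Γ h ≡ (v , u))

-- a cycle of length (suc k) inside the edge set X: distinct vertices
-- w 0, …, w k and distinct edges c 0, …, c k of X, with c i joining
-- w i and w (i+1 mod (suc k)).  (Length 1 = loop, length 2 = pair of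
-- parallel edges.)
record CycleIn {m} (Γ : Graph m) (X : Subset m) : Set where
  field
    k     : ℕ
    w     : Fin (suc k) → Fin (V Γ)
    c     : Fin (suc k) → Fin m
    w-inj : Injective _≡_ _≡_ w
    c-inj : Injective _≡_ _≡_ c
    c∈X   : ∀ i → c i ∈ X
    joins : ∀ i → Joins Γ (c i) (w i) (w (next i))

Acyclic : ∀ {m} → Graph m → Subset m → Set
Acyclic Γ X = ¬ CycleIn Γ X

-- Multilinear polynomials over ℚ in variables y_0 … y_{m-1}, given by
-- their coefficient function on square-free monomials y^X, X ⊆ E.

MPoly : ℕ → Set
MPoly m = Subset m → ℚ

allSubsets : ∀ m → List (Subset m)
allSubsets zero    = [] ∷ []
allSubsets (suc m) = map (false ∷_) (allSubsets m) ++ map (true ∷_) (allSubsets m)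

sumℚ : List ℚ → ℚ
sumℚ = foldr _+ℚ_ 0ℚ

mono : ∀ {m} → Subset m → (Fin m → ℚ) → ℚ
mono []           y = 1ℚ
mono (b ∷ X) y = (if b then y zero else 1ℚ) *ℚ mono X (λ i → y (suc i))

eval : ∀ {m} → MPoly m → (Fin m → ℚ) → ℚ
eval {m} P y = sumℚ (map (λ X → P X *ℚ mono X y) (allSubsets m))

-- spanning forest polynomial Σ_{X acyclic} y^X (given any decision
-- procedure for acyclicity; the result does not depend on it)
sfp : ∀ {m} (Γ : Graph m) → (∀ X → Dec (Acyclic Γ X)) → MPoly m
sfp Γ dec X with dec X
... | yes _ = 1ℚ
... | no  _ = 0ℚ

-- partial derivative ∂/∂y_f of a multilinear polynomial:
-- ∂_f (Σ_X c_X y^X) = Σ_{X ∋ f} c_X y^{X∖f}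
∂ : ∀ {m} → Fin m → MPoly m → MPoly m
∂ f P X = if lookup X f then 0ℚ else P (X [ f ]≔ true)

at0 : ∀ {m} → Fin m → MPoly m → MPoly m
at0 f P X = if lookup X f then 0ℚ else P X

-- Φ P {e} = (P^e − P_e) P_e, as a function of the point y
Φ : ∀ {m} → Fin m → MPoly m → (Fin m → ℚ) → ℚ
Φ e P y = (eval (at0 e P) y -ℚ eval (∂ e P) y) *ℚ eval (∂ e P) y

Ψ : ∀ {m} → Fin m → Fin m → MPoly m → (Fin m → ℚ) → ℚ
Ψ e f G y =
  (eval (∂ f (at0 e G)) y *ℚ eval (∂ e (at0 f G)) y
   +ℚ eval (at0 e (at0 f G)) y *ℚ eval (∂ e (∂ f G)) y)
  -ℚ (2ℚ *ℚ eval (∂ e (at0 f G)) y) *ℚ eval (∂ e (∂ f G)) y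
  where
  2ℚ = 1ℚ +ℚ 1ℚ

-- The two-sum has
-- edges Fin (a + b): H-edge punchIn gH i ↦ i ↑ˡ b and K-edge
-- punchIn gK j ↦ a ↑ʳ j.  Vertices: Fin (V H + V K); the endpoints
-- (p , q) of gK are identified with the endpoints (s , t) of gH
-- (flip = true: with (t , s)); the images of p, q in the right block
-- remain as isolated vertices, which does not affect forests.

twoSum : ∀ {a b} (H : Graph (suc a)) (gH : Fin (suc a))
         (K : Graph (suc b)) (gK : Fin (suc b)) (flip : Bool) → Graph (a + b)
twoSum {a} {b} H gH K gK flip = record { V = V H + V K ; ends = es }
  where
  s t : Fin (V H)
  s = if flip then proj₂ (ends H gH) else proj₁ (ends H gH)
  t = if flip then proj₁ (ends H gH) else proj₂ (ends H gH)
  mapH : Fin (V H) → Fin (V H + V K)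
  mapH u = u ↑ˡ V K
  mapK : Fin (V K) → Fin (V H + V K)
  mapK v with v ≟ proj₁ (ends K gK)
  ... | yes _ = mapH s
  ... | no  _ with v ≟ proj₂ (ends K gK)
  ...   | yes _ = mapH t
  ...   | no  _ = V H ↑ʳ v
  es : Fin (a + b) → Fin (V H + V K) × Fin (V H + V K)
  es i with splitAt a i
  ... | inj₁ i' = mapH (proj₁ (ends H (punchIn gH i'))) , mapH (proj₂ (ends H (punchIn gH i')))
  ... | inj₂ j' = mapK (proj₁ (ends K (punchIn gK j'))) , mapK (proj₂ (ends K (punchIn gK j')))

-- The first identity holds for every multilinear polynomial P: write P = P^f + y_f P_f; for e ≠ f,
-- setting y_e = 0 and differentiating in y_e commute with this decomposition, so Φ P{e} is a quadratic
-- polynomial in y_f whose coefficients are Φ P^f{e}, Ψ P{e|f} and Φ P_f{e}.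
--
-- For the two-sum G = H ⊕_g K, an edge set X_H ∪ X_K of G is a forest iff X_H is a forest of H − g,
-- X_K is a forest of K − g, and X_H + g or X_K + g is a forest: a cycle of G either lies in one side,
-- or it is an H-path plus a K-path between the two glued vertices, each of which closes up with g.
-- On coefficients this reads G = H_g K^g + (H^g − H_g) K_g = K_g (H^g + c H_g) with K_g c = K^g − K_g,
-- that is, G is K_g times H evaluated at y_g = c.  The same relation survives setting y_e = 0 or
-- differentiating in y_e for an edge e of H, so Φ G{e} = K_g² Φ H{e}.  The hypothesis K_g ≠ 0
-- excludes the case that g is a loop of K, where the characterisation of forests fails.

module Submission where

open import Defs
open import Data.Bool using (Bool; true; false; if_then_else_)
open import Data.Empty using (⊥-elim)
open import Data.Fin using (Fin; zero; suc; punchIn; punchOut; _↑ˡ_; _↑ʳ_; splitAt; inject₁; fromℕ; toℕ; _≟_)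
open import Data.Fin.Properties
  using (any?; 0≢1+n; suc-injective; inject₁-injective; fromℕ≢inject₁; toℕ-inject₁; toℕ<n;
         ↑ˡ-injective; ↑ʳ-injective; splitAt-↑ˡ; splitAt-↑ʳ; splitAt⁻¹-↑ˡ; splitAt⁻¹-↑ʳ;
         punchIn-injective; punchInᵢ≢i; punchIn-punchOut)
open import Data.Fin.Subset using (Subset) renaming (_∈_ to _∈ₛ_)
open import Data.List
  using (List; []; _∷_; _++_; _∷ʳ_; [_]; map; length; take; drop; reverse; tabulate) renaming (lookup to lookupₗ)
open import Data.List.Properties using (map-++; map-∘; ++-assoc; ++-identityʳ; unfold-reverse; take++drop≡id; length-take)
open import Data.List.Membership.Propositional using (_∈_; _∉_)
open import Data.List.Membership.Propositional.Properties
  using (∈-++⁺ˡ; ∈-++⁺ʳ; ∈-++⁻; ∈-map⁺; ∈-map⁻; ∈-lookup; ∈-∃++; ∈-tabulate⁻)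
open import Data.List.Relation.Unary.All as All using (All; []; _∷_)
open import Data.List.Relation.Unary.All.Properties
  using (++⁻ˡ; ++⁻ʳ; ++⁺; tabulate⁺) renaming (map⁺ to All-map⁺; map⁻ to All-map⁻)
open import Data.List.Relation.Unary.Any using (here; there) renaming (any? to anyₗ?)
import Data.List.Relation.Unary.Any.Properties as Any
open import Data.Nat using (zero; suc; _<_; _≤_; s≤s) renaming (_+_ to _+ℕ_)
open import Data.Nat.Properties using (≤-trans; ≤-refl; ≤-pred; n≤1+n; m⊓n≤m)
open import Data.Product using (Σ-syntax; _×_; _,_; proj₁; proj₂)
open import Data.Rational using (ℚ; 0ℚ; 1ℚ; _+_; _*_; _-_; _÷_; 1/_; NonZero; ≢-nonZero)
open import Data.Rational.Properties using (+-identityˡ; +-identityʳ; *-identityˡ; *-identityʳ; *-zeroˡ; *-zeroʳ; *-inverseʳ)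
open import Data.Rational.Solver using (module +-*-Solver)
open import Data.Sum using (_⊎_; inj₁; inj₂; [_,_]′) renaming (map to map-⊎)
open import Data.Vec using ([]; _∷_; lookup; _[_]≔_; here; there) renaming (insertAt to insertAtᵥ; _++_ to _++ᵥ_)
open import Data.Vec.Properties
  using (insertAt-lookup; insertAt-punchIn; lookup∘update′; []≔-commutes; lookup-++ˡ; lookup-++ʳ; []≔-++-↑ˡ;
         []≔-updates; lookup⇒[]=; []=⇒lookup)
open import Data.Vec.Functional using (insertAt; removeAt)
open import Data.Vec.Functional.Properties using (insertAt-removeAt)
open import Function using (_∘_; case_of_; _⇔_; mk⇔; Equivalence)
open import Relation.Binary.PropositionalEquality hiding ([_])
open import Relation.Nullary using (¬_; Dec; yes; no)
open import Relation.Nullary.Decidable using (_×-dec_; _⊎-dec_)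

open +-*-Solver using (solve; _:+_; _:*_; _:-_; _:=_; con)

-- Sums over subsets and evaluation of multilinear polynomials

sumSubsets : ∀ m → (Subset m → ℚ) → ℚ
sumSubsets m F = sumℚ (map F (allSubsets m))

sumℚ-++ : ∀ (xs ys : List ℚ) → sumℚ (xs ++ ys) ≡ sumℚ xs + sumℚ ys
sumℚ-++ []       ys = sym (+-identityˡ _)
sumℚ-++ (x ∷ xs) ys = trans (cong (x +_) (sumℚ-++ xs ys))
  (solve 3 (λ a b c → a :+ (b :+ c) := (a :+ b) :+ c) refl x (sumℚ xs) (sumℚ ys))

module _ {A : Set} where

  sumℚ-map-cong : ∀ {F F' : A → ℚ} xs → (∀ x → F x ≡ F' x) → sumℚ (map F xs) ≡ sumℚ (map F' xs)
  sumℚ-map-cong []       F≗F' = refl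
  sumℚ-map-cong (x ∷ xs) F≗F' = cong₂ _+_ (F≗F' x) (sumℚ-map-cong xs F≗F')

  sumℚ-map-+ : ∀ (F F' : A → ℚ) xs → sumℚ (map (λ x → F x + F' x) xs) ≡ sumℚ (map F xs) + sumℚ (map F' xs)
  sumℚ-map-+ F F' []       = sym (+-identityˡ _)
  sumℚ-map-+ F F' (x ∷ xs) = trans (cong (F x + F' x +_) (sumℚ-map-+ F F' xs))
    (solve 4 (λ a b c d → (a :+ b) :+ (c :+ d) := (a :+ c) :+ (b :+ d)) refl
      (F x) (F' x) (sumℚ (map F xs)) (sumℚ (map F' xs)))

  sumℚ-map-* : ∀ c (F : A → ℚ) xs → sumℚ (map (λ x → c * F x) xs) ≡ c * sumℚ (map F xs)
  sumℚ-map-* c F []       = sym (*-zeroʳ c)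
  sumℚ-map-* c F (x ∷ xs) = trans (cong (c * F x +_) (sumℚ-map-* c F xs))
    (solve 3 (λ c a b → c :* a :+ c :* b := c :* (a :+ b)) refl c (F x) (sumℚ (map F xs)))

sumSubsets-cong : ∀ m {F F'} → (∀ X → F X ≡ F' X) → sumSubsets m F ≡ sumSubsets m F'
sumSubsets-cong m = sumℚ-map-cong (allSubsets m)

sumSubsets-+ : ∀ m F F' → sumSubsets m (λ X → F X + F' X) ≡ sumSubsets m F + sumSubsets m F'
sumSubsets-+ m F F' = sumℚ-map-+ F F' (allSubsets m)

sumSubsets-* : ∀ m c F → sumSubsets m (λ X → c * F X) ≡ c * sumSubsets m F
sumSubsets-* m c F = sumℚ-map-* c F (allSubsets m)

sumSubsets-suc : ∀ m F → sumSubsets (suc m) F ≡ sumSubsets m (λ X → F (false ∷ X)) + sumSubsets m (λ X → F (true ∷ X))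
sumSubsets-suc m F = begin
  sumℚ (map F (map (false ∷_) Xs ++ map (true ∷_) Xs))
    ≡⟨ cong sumℚ (map-++ F (map (false ∷_) Xs) (map (true ∷_) Xs)) ⟩
  sumℚ (map F (map (false ∷_) Xs) ++ map F (map (true ∷_) Xs))
    ≡⟨ sumℚ-++ (map F (map (false ∷_) Xs)) (map F (map (true ∷_) Xs)) ⟩
  sumℚ (map F (map (false ∷_) Xs)) + sumℚ (map F (map (true ∷_) Xs))
    ≡⟨ sym (cong₂ _+_ (cong sumℚ (map-∘ Xs)) (cong sumℚ (map-∘ Xs))) ⟩
  sumSubsets m (λ X → F (false ∷ X)) + sumSubsets m (λ X → F (true ∷ X))
    ∎
  where
  open ≡-Reasoning
  Xs = allSubsets m

sumSubsets-insertAt : ∀ m (g : Fin (suc m)) F →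
  sumSubsets (suc m) F ≡ sumSubsets m (λ X → F (insertAtᵥ X g false) + F (insertAtᵥ X g true))
sumSubsets-insertAt m       zero    F = trans (sumSubsets-suc m F) (sym (sumSubsets-+ m _ _))
sumSubsets-insertAt (suc m) (suc g) F = begin
  sumSubsets (suc (suc m)) F
    ≡⟨ sumSubsets-suc (suc m) F ⟩
  sumSubsets (suc m) (λ X → F (false ∷ X)) + sumSubsets (suc m) (λ X → F (true ∷ X))
    ≡⟨ cong₂ _+_ (sumSubsets-insertAt m g _) (sumSubsets-insertAt m g _) ⟩
  sumSubsets m (λ X → F (false ∷ insertAtᵥ X g false) + F (false ∷ insertAtᵥ X g true))
    + sumSubsets m (λ X → F (true ∷ insertAtᵥ X g false) + F (true ∷ insertAtᵥ X g true))
    ≡⟨ sym (sumSubsets-suc m _) ⟩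
  sumSubsets (suc m) (λ X → F (insertAtᵥ X (suc g) false) + F (insertAtᵥ X (suc g) true))
    ∎
  where open ≡-Reasoning

sumSubsets-++ : ∀ a b F → sumSubsets (a +ℕ b) F ≡ sumSubsets a (λ XH → sumSubsets b (λ XK → F (XH ++ᵥ XK)))
sumSubsets-++ zero    b F = sym (+-identityʳ _)
sumSubsets-++ (suc a) b F = trans (sumSubsets-suc (a +ℕ b) F)
  (trans (cong₂ _+_ (sumSubsets-++ a b _) (sumSubsets-++ a b _)) (sym (sumSubsets-suc a _)))

mono-cong : ∀ {m} (X : Subset m) {y y' : Fin m → ℚ} → (∀ i → y i ≡ y' i) → mono X y ≡ mono X y'
mono-cong []          y≗y' = refl
mono-cong (false ∷ X) y≗y' = cong (1ℚ *_) (mono-cong X (λ i → y≗y' (suc i)))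
mono-cong (true  ∷ X) y≗y' = cong₂ _*_ (y≗y' zero) (mono-cong X (λ i → y≗y' (suc i)))

mono-insertAt-false : ∀ {m} (X : Subset m) g (y : Fin m → ℚ) c →
  mono (insertAtᵥ X g false) (insertAt y g c) ≡ mono X y
mono-insertAt-false X           zero    y c = *-identityˡ _
mono-insertAt-false (false ∷ X) (suc g) y c = cong (1ℚ *_) (mono-insertAt-false X g _ c)
mono-insertAt-false (true  ∷ X) (suc g) y c = cong (y zero *_) (mono-insertAt-false X g _ c)

mono-insertAt-true : ∀ {m} (X : Subset m) g (y : Fin m → ℚ) c →
  mono (insertAtᵥ X g true) (insertAt y g c) ≡ c * mono X y
mono-insertAt-true X       zero    y c = refl
mono-insertAt-true (b ∷ X) (suc g) y c = trans (cong ((if b then y zero else 1ℚ) *_) (mono-insertAt-true X g _ c))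
  (solve 3 (λ o c m → o :* (c :* m) := c :* (o :* m)) refl (if b then y zero else 1ℚ) c _)

mono-++ : ∀ {a b} (XH : Subset a) (XK : Subset b) (y : Fin (a +ℕ b) → ℚ) →
  mono (XH ++ᵥ XK) y ≡ mono XH (λ i → y (i ↑ˡ b)) * mono XK (λ j → y (a ↑ʳ j))
mono-++ []       XK y = sym (*-identityˡ _)
mono-++ (x ∷ XH) XK y = trans (cong ((if x then y zero else 1ℚ) *_) (mono-++ XH XK (λ i → y (suc i))))
  (solve 3 (λ a b c → a :* (b :* c) := (a :* b) :* c) refl (if x then y zero else 1ℚ) _ _)

eval-cong : ∀ {m} {P Q : MPoly m} y → (∀ X → P X ≡ Q X) → eval P y ≡ eval Q y
eval-cong {m} y P≗Q = sumSubsets-cong m (λ X → cong (_* _) (P≗Q X))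

eval-congʳ : ∀ {m} (P : MPoly m) {y y' : Fin m → ℚ} → (∀ i → y i ≡ y' i) → eval P y ≡ eval P y'
eval-congʳ {m} P y≗y' = sumSubsets-cong m (λ X → cong (P X *_) (mono-cong X y≗y'))

eval-zero : ∀ {m} (y : Fin m → ℚ) → eval (λ _ → 0ℚ) y ≡ 0ℚ
eval-zero {m} y = trans (sumSubsets-* m 0ℚ (λ X → mono X y)) (*-zeroˡ (sumSubsets m (λ X → mono X y)))

slice : ∀ {m} → Fin (suc m) → Bool → MPoly (suc m) → MPoly m
slice g b P X = P (insertAtᵥ X g b)

eval-insertAt : ∀ {m} (P : MPoly (suc m)) g (y : Fin m → ℚ) c →
  eval P (insertAt y g c) ≡ eval (slice g false P) y + c * eval (slice g true P) y
eval-insertAt {m} P g y c = begin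
  eval P (insertAt y g c)
    ≡⟨ sumSubsets-insertAt m g _ ⟩
  sumSubsets m (λ X → P (insertAtᵥ X g false) * mono (insertAtᵥ X g false) (insertAt y g c)
                    + P (insertAtᵥ X g true) * mono (insertAtᵥ X g true) (insertAt y g c))
    ≡⟨ sumSubsets-cong m (λ X → cong₂ _+_ (cong (P (insertAtᵥ X g false) *_) (mono-insertAt-false X g y c))
                                         (trans (cong (P (insertAtᵥ X g true) *_) (mono-insertAt-true X g y c))
                                                (swap (P (insertAtᵥ X g true)) c (mono X y)))) ⟩
  sumSubsets m (λ X → slice g false P X * mono X y + c * (slice g true P X * mono X y))
    ≡⟨ trans (sumSubsets-+ m _ _) (cong (eval (slice g false P) y +_) (sumSubsets-* m c (λ X → slice g true P X * mono X y))) ⟩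
  eval (slice g false P) y + c * eval (slice g true P) y
    ∎
  where
  open ≡-Reasoning
  swap : ∀ p c q → p * (c * q) ≡ c * (p * q)
  swap = solve 3 (λ p c q → p :* (c :* q) := c :* (p :* q)) refl

at0-insertAt-false : ∀ {m} (P : MPoly (suc m)) g X → at0 g P (insertAtᵥ X g false) ≡ P (insertAtᵥ X g false)
at0-insertAt-false P g X rewrite insertAt-lookup X g false = refl

at0-insertAt-true : ∀ {m} (P : MPoly (suc m)) g X → at0 g P (insertAtᵥ X g true) ≡ 0ℚ
at0-insertAt-true P g X rewrite insertAt-lookup X g true = refl

insertAt-[]≔ : ∀ {m} (X : Subset m) g b v → insertAtᵥ X g b [ g ]≔ v ≡ insertAtᵥ X g v
insertAt-[]≔ X       zero    b v = refl
insertAt-[]≔ (x ∷ X) (suc g) b v = cong (x ∷_) (insertAt-[]≔ X g b v)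

∂-insertAt-false : ∀ {m} (P : MPoly (suc m)) g X → ∂ g P (insertAtᵥ X g false) ≡ P (insertAtᵥ X g true)
∂-insertAt-false P g X rewrite insertAt-lookup X g false | insertAt-[]≔ X g false true = refl

∂-insertAt-true : ∀ {m} (P : MPoly (suc m)) g X → ∂ g P (insertAtᵥ X g true) ≡ 0ℚ
∂-insertAt-true P g X rewrite insertAt-lookup X g true = refl

eval-at0-insertAt : ∀ {m} (P : MPoly (suc m)) g (y : Fin m → ℚ) c →
  eval (at0 g P) (insertAt y g c) ≡ eval (slice g false P) y
eval-at0-insertAt P g y c = begin
  eval (at0 g P) (insertAt y g c)
    ≡⟨ eval-insertAt (at0 g P) g y c ⟩
  eval (slice g false (at0 g P)) y + c * eval (slice g true (at0 g P)) y
    ≡⟨ cong₂ (λ u v → u + c * v) (eval-cong y (at0-insertAt-false P g))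
                                 (trans (eval-cong y (at0-insertAt-true P g)) (eval-zero y)) ⟩
  eval (slice g false P) y + c * 0ℚ
    ≡⟨ trans (cong (eval (slice g false P) y +_) (*-zeroʳ c)) (+-identityʳ _) ⟩
  eval (slice g false P) y
    ∎
  where open ≡-Reasoning

eval-∂-insertAt : ∀ {m} (P : MPoly (suc m)) g (y : Fin m → ℚ) c →
  eval (∂ g P) (insertAt y g c) ≡ eval (slice g true P) y
eval-∂-insertAt P g y c = begin
  eval (∂ g P) (insertAt y g c)
    ≡⟨ eval-insertAt (∂ g P) g y c ⟩
  eval (slice g false (∂ g P)) y + c * eval (slice g true (∂ g P)) y
    ≡⟨ cong₂ (λ u v → u + c * v) (eval-cong y (∂-insertAt-false P g))
                                 (trans (eval-cong y (∂-insertAt-true P g)) (eval-zero y)) ⟩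
  eval (slice g true P) y + c * 0ℚ
    ≡⟨ trans (cong (eval (slice g true P) y +_) (*-zeroʳ c)) (+-identityʳ _) ⟩
  eval (slice g true P) y
    ∎
  where open ≡-Reasoning

eval-linear : ∀ {m} (f : Fin m) (P : MPoly m) (y : Fin m → ℚ) →
  eval P y ≡ eval (at0 f P) y + y f * eval (∂ f P) y
eval-linear {suc m} f P y = begin
  eval P y
    ≡⟨ eval-congʳ P (λ i → sym (insertAt-removeAt y f i)) ⟩
  eval P y'
    ≡⟨ eval-insertAt P f (removeAt y f) (y f) ⟩
  eval (slice f false P) (removeAt y f) + y f * eval (slice f true P) (removeAt y f)
    ≡⟨ sym (cong₂ (λ u v → u + y f * v) (eval-at0-insertAt P f _ (y f)) (eval-∂-insertAt P f _ (y f))) ⟩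
  eval (at0 f P) y' + y f * eval (∂ f P) y'
    ≡⟨ cong₂ (λ u v → u + y f * v) (eval-congʳ (at0 f P) (insertAt-removeAt y f))
                                   (eval-congʳ (∂ f P) (insertAt-removeAt y f)) ⟩
  eval (at0 f P) y + y f * eval (∂ f P) y
    ∎
  where
  open ≡-Reasoning
  y' = insertAt (removeAt y f) f (y f)

-- Expansion of Φ in a second variable

at0-comm : ∀ {m} (e f : Fin m) (P : MPoly m) X → at0 f (at0 e P) X ≡ at0 e (at0 f P) X
at0-comm e f P X with lookup X e | lookup X f
... | true  | true  = refl
... | true  | false = refl
... | false | true  = refl
... | false | false = refl

at0-∂-comm : ∀ {m} {e f : Fin m} → e ≢ f → (P : MPoly m) → ∀ X → at0 f (∂ e P) X ≡ ∂ e (at0 f P) X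
at0-∂-comm {e = e} {f} e≢f P X rewrite lookup∘update′ (λ f≡e → e≢f (sym f≡e)) X true with lookup X e | lookup X f
... | true  | true  = refl
... | true  | false = refl
... | false | true  = refl
... | false | false = refl

∂-comm : ∀ {m} {e f : Fin m} → e ≢ f → (P : MPoly m) → ∀ X → ∂ f (∂ e P) X ≡ ∂ e (∂ f P) X
∂-comm {e = e} {f} e≢f P X
  rewrite lookup∘update′ (λ f≡e → e≢f (sym f≡e)) X true | lookup∘update′ e≢f X true
        | []≔-commutes {x = true} {y = true} X e f e≢f
  with lookup X e | lookup X f
... | true  | true  = refl
... | true  | false = refl
... | false | true  = refl
... | false | false = refl

Φ-expand : ∀ {m} (P : MPoly m) {e f : Fin m} → e ≢ f → ∀ y →
  Φ e P y ≡ (Φ e (at0 f P) y + y f * Ψ e f P y) + (y f * y f) * Φ e (∂ f P) y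
Φ-expand P {e} {f} e≢f y = begin
  (eval (at0 e P) y - eval (∂ e P) y) * eval (∂ e P) y
    ≡⟨ cong₂ (λ u v → (u - v) * v) (eval-linear f (at0 e P) y) (eval-linear f (∂ e P) y) ⟩
  ((A + y f * B) - (C + y f * D)) * (C + y f * D)
    ≡⟨ cong₂ (λ u v → ((A + y f * B) - (u + y f * v)) * (u + y f * v))
         (eval-cong y (at0-∂-comm e≢f P)) (eval-cong y (∂-comm e≢f P)) ⟩
  ((A + y f * B) - (C' + y f * D')) * (C' + y f * D')
    ≡⟨ cong (λ u → ((u + y f * B) - (C' + y f * D')) * (C' + y f * D')) (eval-cong y (at0-comm e f P)) ⟩
  ((A' + y f * B) - (C' + y f * D')) * (C' + y f * D')
    ≡⟨ expand (y f) A' B C' D' ⟩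
  ((A' - C') * C' + y f * ((B * C' + A' * D') - ((1ℚ + 1ℚ) * C') * D')) + (y f * y f) * ((B - D') * D')
    ≡⟨ cong (λ u → ((A' - C') * C' + y f * ((B * C' + A' * D') - ((1ℚ + 1ℚ) * C') * D')) + (y f * y f) * ((u - D') * D'))
         (eval-cong y (λ X → sym (at0-∂-comm (λ f≡e → e≢f (sym f≡e)) P X))) ⟩
  (Φ e (at0 f P) y + y f * Ψ e f P y) + (y f * y f) * Φ e (∂ f P) y
    ∎
  where
  open ≡-Reasoning
  A  = eval (at0 f (at0 e P)) y
  B  = eval (∂ f (at0 e P)) y
  C  = eval (at0 f (∂ e P)) y
  D  = eval (∂ f (∂ e P)) y
  A' = eval (at0 e (at0 f P)) y
  C' = eval (∂ e (at0 f P)) y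
  D' = eval (∂ e (∂ f P)) y
  expand : ∀ t A B C D →
    ((A + t * B) - (C + t * D)) * (C + t * D) ≡
    ((A - C) * C + t * ((B * C + A * D) - ((1ℚ + 1ℚ) * C) * D)) + (t * t) * ((B - D) * D)
  expand = solve 5 (λ t A B C D → ((A :+ t :* B) :- (C :+ t :* D)) :* (C :+ t :* D) :=
    ((A :- C) :* C :+ t :* ((B :* C :+ A :* D) :- ((con 1ℚ :+ con 1ℚ) :* C) :* D)) :+ (t :* t) :* ((B :- D) :* D)) refl

-- The polynomial of a two-sum in terms of its summands

IsTwoSumProduct : ∀ {a b} → MPoly (suc a) → Fin (suc a) → MPoly (suc b) → Fin (suc b) → MPoly (a +ℕ b) → Set
IsTwoSumProduct H gH K gK G = ∀ XH XK →
  G (XH ++ᵥ XK) ≡ slice gH true H XH * slice gK false K XK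
                  + (slice gH false H XH - slice gH true H XH) * slice gK true K XK

insertAt-[punchIn]≔ : ∀ {m} (X : Subset m) g b i v → insertAtᵥ X g b [ punchIn g i ]≔ v ≡ insertAtᵥ (X [ i ]≔ v) g b
insertAt-[punchIn]≔ X       zero    b i       v = refl
insertAt-[punchIn]≔ (x ∷ X) (suc g) b zero    v = refl
insertAt-[punchIn]≔ (x ∷ X) (suc g) b (suc i) v = cong (x ∷_) (insertAt-[punchIn]≔ X g b i v)

sumSubsets-bilinear : ∀ m (P Q : MPoly m) (z : Fin m → ℚ) u v w →
  sumSubsets m (λ X → (u * P X + v * Q X) * (w * mono X z)) ≡ (u * eval P z + v * eval Q z) * w
sumSubsets-bilinear m P Q z u v w = begin
  sumSubsets m (λ X → (u * P X + v * Q X) * (w * mono X z))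
    ≡⟨ sumSubsets-cong m (λ X → distrib (P X) (Q X) (mono X z)) ⟩
  sumSubsets m (λ X → (w * u) * (P X * mono X z) + (w * v) * (Q X * mono X z))
    ≡⟨ trans (sumSubsets-+ m _ _) (cong₂ _+_ (sumSubsets-* m (w * u) _) (sumSubsets-* m (w * v) _)) ⟩
  (w * u) * eval P z + (w * v) * eval Q z
    ≡⟨ solve 5 (λ u v w p q → (w :* u) :* p :+ (w :* v) :* q := (u :* p :+ v :* q) :* w) refl u v w (eval P z) (eval Q z) ⟩
  (u * eval P z + v * eval Q z) * w
    ∎
  where
  open ≡-Reasoning
  distrib : ∀ p q μ → (u * p + v * q) * (w * μ) ≡ (w * u) * (p * μ) + (w * v) * (q * μ)
  distrib = solve 6 (λ u v w p q μ → (u :* p :+ v :* q) :* (w :* μ) := (w :* u) :* (p :* μ) :+ (w :* v) :* (q :* μ)) refl u v w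

module _ {a b} {H : MPoly (suc a)} {gH : Fin (suc a)} {K : MPoly (suc b)} {gK : Fin (suc b)} {G : MPoly (a +ℕ b)}
         (G≡HK : IsTwoSumProduct H gH K gK G) where

  private
    vanish : ∀ k⁰ k¹ → 0ℚ ≡ 0ℚ * k⁰ + (0ℚ - 0ℚ) * k¹
    vanish = solve 2 (λ k⁰ k¹ → con 0ℚ := con 0ℚ :* k⁰ :+ (con 0ℚ :- con 0ℚ) :* k¹) refl

  twoSumProduct-at0 : ∀ e → IsTwoSumProduct (at0 (punchIn gH e) H) gH K gK (at0 (e ↑ˡ b) G)
  twoSumProduct-at0 e XH XK
    rewrite lookup-++ˡ XH XK e | insertAt-punchIn XH gH true e | insertAt-punchIn XH gH false e
    with lookup XH e
  ... | true  = vanish (slice gK false K XK) (slice gK true K XK)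
  ... | false = G≡HK XH XK

  twoSumProduct-∂ : ∀ e → IsTwoSumProduct (∂ (punchIn gH e) H) gH K gK (∂ (e ↑ˡ b) G)
  twoSumProduct-∂ e XH XK
    rewrite lookup-++ˡ XH XK e | []≔-++-↑ˡ {x = true} XH XK e
          | insertAt-punchIn XH gH true e | insertAt-punchIn XH gH false e
          | insertAt-[punchIn]≔ XH gH true e true | insertAt-[punchIn]≔ XH gH false e true
    with lookup XH e
  ... | true  = vanish (slice gK false K XK) (slice gK true K XK)
  ... | false = G≡HK (XH [ e ]≔ true) XK

  eval-twoSumProduct : ∀ (y : Fin (a +ℕ b) → ℚ) c →
    let yH = λ i → y (i ↑ˡ b)
        yK = λ j → y (a ↑ʳ j)
        K⁰ = eval (slice gK false K) yK
        Kg = eval (slice gK true K) yK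
    in Kg * c ≡ K⁰ - Kg → eval G y ≡ Kg * eval H (insertAt yH gH c)
  eval-twoSumProduct y c Kg*c≡K⁰-Kg = begin
    eval G y
      ≡⟨ sumSubsets-++ a b _ ⟩
    sumSubsets a (λ XH → sumSubsets b (λ XK → G (XH ++ᵥ XK) * mono (XH ++ᵥ XK) y))
      ≡⟨ sumSubsets-cong a (λ XH → sumSubsets-cong b (λ XK → cong₂ _*_ (G≡HK XH XK) (mono-++ XH XK y))) ⟩
    sumSubsets a (λ XH → sumSubsets b (λ XK → (H¹ XH * K⁰ₓ XK + (H⁰ XH - H¹ XH) * K¹ₓ XK) * (mono XH yH * mono XK yK)))
      ≡⟨ sumSubsets-cong a (λ XH → sumSubsets-bilinear b K⁰ₓ K¹ₓ yK (H¹ XH) (H⁰ XH - H¹ XH) (mono XH yH)) ⟩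
    sumSubsets a (λ XH → (H¹ XH * K⁰ + (H⁰ XH - H¹ XH) * Kg) * mono XH yH)
      ≡⟨ sumSubsets-cong a (λ XH → rearrange (H⁰ XH) (H¹ XH) (mono XH yH)) ⟩
    sumSubsets a (λ XH → Kg * (H⁰ XH * mono XH yH + c * (H¹ XH * mono XH yH)))
      ≡⟨ trans (sumSubsets-* a Kg _) (cong (Kg *_) (trans (sumSubsets-+ a _ _) (cong (eval H⁰ yH +_) (sumSubsets-* a c _)))) ⟩
    Kg * (eval H⁰ yH + c * eval H¹ yH)
      ≡⟨ cong (Kg *_) (sym (eval-insertAt H gH yH c)) ⟩
    Kg * eval H (insertAt yH gH c)
      ∎
    where
    open ≡-Reasoning
    yH = λ i → y (i ↑ˡ b)
    yK = λ j → y (a ↑ʳ j)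
    H⁰ = slice gH false H
    H¹ = slice gH true H
    K⁰ₓ = slice gK false K
    K¹ₓ = slice gK true K
    K⁰ = eval K⁰ₓ yK
    Kg = eval K¹ₓ yK
    K⁰≡ : K⁰ ≡ Kg * c + Kg
    K⁰≡ = trans (solve 2 (λ k⁰ k → k⁰ := (k⁰ :- k) :+ k) refl K⁰ Kg) (cong (_+ Kg) (sym Kg*c≡K⁰-Kg))
    rearrange : ∀ h⁰ h¹ μ → (h¹ * K⁰ + (h⁰ - h¹) * Kg) * μ ≡ Kg * (h⁰ * μ + c * (h¹ * μ))
    rearrange h⁰ h¹ μ = trans (cong (λ k → (h¹ * k + (h⁰ - h¹) * Kg) * μ) K⁰≡)
      (solve 5 (λ k c h⁰ h¹ μ → (h¹ :* (k :* c :+ k) :+ (h⁰ :- h¹) :* k) :* μ := k :* (h⁰ :* μ :+ c :* (h¹ :* μ)))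
        refl Kg c h⁰ h¹ μ)

Φ-twoSumProduct : ∀ {a b} {H : MPoly (suc a)} {gH : Fin (suc a)} {K : MPoly (suc b)} {gK : Fin (suc b)} {G : MPoly (a +ℕ b)} →
  IsTwoSumProduct H gH K gK G → ∀ e (y : Fin (a +ℕ b) → ℚ) c →
  let yK = λ j → y (a ↑ʳ j)
      K⁰ = eval (slice gK false K) yK
      Kg = eval (slice gK true K) yK
  in Kg * c ≡ K⁰ - Kg → Φ (e ↑ˡ b) G y ≡ (Kg * Kg) * Φ (punchIn gH e) H (insertAt (λ i → y (i ↑ˡ b)) gH c)
Φ-twoSumProduct {a} {b} {H} {gH} {K} {gK} {G} G≡HK e y c Kg*c≡K⁰-Kg =
  trans (cong₂ (λ u v → (u - v) * v)
          (eval-twoSumProduct {H = at0 (punchIn gH e) H} {gH} {K} {gK} {at0 (e ↑ˡ b) G}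
            (twoSumProduct-at0 {H = H} {gH} {K} {gK} {G} G≡HK e) y c Kg*c≡K⁰-Kg)
          (eval-twoSumProduct {H = ∂ (punchIn gH e) H} {gH} {K} {gK} {∂ (e ↑ˡ b) G}
            (twoSumProduct-∂ {H = H} {gH} {K} {gK} {G} G≡HK e) y c Kg*c≡K⁰-Kg))
        (solve 3 (λ k u v → (k :* u :- k :* v) :* (k :* v) := (k :* k) :* ((u :- v) :* v)) refl
          (eval (slice gK true K) (λ j → y (a ↑ʳ j)))
          (eval (at0 (punchIn gH e) H) y') (eval (∂ (punchIn gH e) H) y'))
  where y' = insertAt (λ i → y (i ↑ˡ b)) gH c

module _ {A : Set} where

  map-≢[] : ∀ {B : Set} {f : A → B} {xs} → xs ≢ [] → map f xs ≢ []
  map-≢[] {xs = []}    xs≢[] _ = xs≢[] refl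
  map-≢[] {xs = _ ∷ _} xs≢[] ()

  map-[] : ∀ {B C : Set} {f : A → B} {g : A → C} xs → map f xs ≡ [] → map g xs ≡ []
  map-[] [] _ = refl

  ∷ʳ-≢[] : ∀ (xs : List A) {x} → xs ∷ʳ x ≢ []
  ∷ʳ-≢[] []      ()
  ∷ʳ-≢[] (_ ∷ _) ()

  ++-≡[] : ∀ (xs : List A) {ys} → xs ++ ys ≡ [] → (xs ≡ []) × (ys ≡ [])
  ++-≡[] [] ys≡[] = refl , ys≡[]

  reverse-≡[] : ∀ {xs : List A} → reverse xs ≡ [] → xs ≡ []
  reverse-≡[] {[]}     _ = refl
  reverse-≡[] {x ∷ xs} e rewrite unfold-reverse x xs = ⊥-elim (∷ʳ-≢[] (reverse xs) e)

  All-reverse : ∀ {P : A → Set} {xs} → All P xs → All P (reverse xs)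
  All-reverse ax = All.tabulate (All.lookup ax ∘ Any.reverse⁻)

_∈?_ : ∀ {n} (g : Fin n) xs → Dec (g ∈ xs)
g ∈? xs = anyₗ? (g ≟_) xs

unpunchIn : ∀ {n} (g : Fin (suc n)) hs → g ∉ hs → Σ[ is ∈ List (Fin n) ] (hs ≡ map (punchIn g) is)
unpunchIn g []       _  = [] , refl
unpunchIn g (h ∷ hs) g∉ with unpunchIn g hs (g∉ ∘ there)
... | is , eq = punchOut (g∉ ∘ here) ∷ is , cong₂ _∷_ (sym (punchIn-punchOut (g∉ ∘ here))) eq

data Distinct {A : Set} : List A → Set where
  []  : Distinct []
  _∷_ : ∀ {x xs} → x ∉ xs → Distinct xs → Distinct (x ∷ xs)

module _ {A : Set} where

  distinct-++ˡ : ∀ (xs : List A) {ys} → Distinct (xs ++ ys) → Distinct xs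
  distinct-++ˡ []       d        = []
  distinct-++ˡ (x ∷ xs) (x∉ ∷ d) = (λ x∈ → x∉ (∈-++⁺ˡ x∈)) ∷ distinct-++ˡ xs d

  distinct-++ʳ : ∀ (xs : List A) {ys} → Distinct (xs ++ ys) → Distinct ys
  distinct-++ʳ []       d       = d
  distinct-++ʳ (x ∷ xs) (_ ∷ d) = distinct-++ʳ xs d

  distinct-++-disjoint : ∀ (xs : List A) {ys} → Distinct (xs ++ ys) → ∀ {z} → z ∈ xs → z ∉ ys
  distinct-++-disjoint (x ∷ xs) (x∉ ∷ d) (here refl) z∈ys = x∉ (∈-++⁺ʳ xs z∈ys)
  distinct-++-disjoint (x ∷ xs) (_  ∷ d) (there z∈)  z∈ys = distinct-++-disjoint xs d z∈ z∈ys

  distinct-++ : ∀ {xs ys : List A} → Distinct xs → Distinct ys → (∀ {z} → z ∈ xs → z ∉ ys) → Distinct (xs ++ ys)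
  distinct-++ []                dys disj = dys
  distinct-++ {x ∷ xs} (x∉ ∷ dxs) dys disj =
    (λ x∈ → [ x∉ , disj (here refl) ]′ (∈-++⁻ xs x∈)) ∷ distinct-++ dxs dys (λ z∈ → disj (there z∈))

  distinct-++-comm : ∀ (xs : List A) {ys} → Distinct (xs ++ ys) → Distinct (ys ++ xs)
  distinct-++-comm xs d =
    distinct-++ (distinct-++ʳ xs d) (distinct-++ˡ xs d) (λ z∈ys z∈xs → distinct-++-disjoint xs d z∈xs z∈ys)

  distinct-infix : ∀ (l : List A) {s r} → Distinct (l ++ s ++ r) → Distinct s
  distinct-infix l {s} d = distinct-++ˡ s (distinct-++ʳ l d)

  distinct-lookup-injective : ∀ {xs : List A} → Distinct xs → ∀ {i j} → lookupₗ xs i ≡ lookupₗ xs j → i ≡ j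
  distinct-lookup-injective (x∉ ∷ d) {zero}  {zero}  eq = refl
  distinct-lookup-injective (x∉ ∷ d) {zero}  {suc j} eq = ⊥-elim (x∉ (subst (_∈ _) (sym eq) (∈-lookup j)))
  distinct-lookup-injective (x∉ ∷ d) {suc i} {zero}  eq = ⊥-elim (x∉ (subst (_∈ _) eq (∈-lookup i)))
  distinct-lookup-injective (x∉ ∷ d) {suc i} {suc j} eq = cong suc (distinct-lookup-injective d eq)

  distinct-tabulate : ∀ {n} (f : Fin n → A) → (∀ {i j} → f i ≡ f j → i ≡ j) → Distinct (tabulate f)
  distinct-tabulate {zero}  f inj = []
  distinct-tabulate {suc n} f inj =
    (λ f0∈ → let (i , eq) = ∈-tabulate⁻ f0∈ in 0≢1+n (inj eq))
    ∷ distinct-tabulate (λ i → f (suc i)) (λ eq → suc-injective (inj eq))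

  distinct-∷ʳ : ∀ {xs : List A} {x} → Distinct xs → x ∉ xs → Distinct (xs ∷ʳ x)
  distinct-∷ʳ d x∉ = distinct-++ d ((λ ()) ∷ []) (λ { z∈ (here refl) → x∉ z∈ })

  distinct-reverse : ∀ {xs : List A} → Distinct xs → Distinct (reverse xs)
  distinct-reverse []               = []
  distinct-reverse {x ∷ xs} (x∉ ∷ d) rewrite unfold-reverse x xs =
    distinct-∷ʳ (distinct-reverse d) (λ x∈ → x∉ (Any.reverse⁻ x∈))

module _ {A B : Set} (f : A → B) where

  distinct-map : (∀ {x y} → f x ≡ f y → x ≡ y) → ∀ {xs} → Distinct xs → Distinct (map f xs)
  distinct-map inj []       = []
  distinct-map inj (x∉ ∷ d) =
    (λ fx∈ → let (z , z∈ , eq) = ∈-map⁻ f fx∈ in x∉ (subst (_∈ _) (sym (inj eq)) z∈)) ∷ distinct-map inj d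

  distinct-map⁻ : ∀ {xs} → Distinct (map f xs) → Distinct xs
  distinct-map⁻ {[]}     d         = []
  distinct-map⁻ {x ∷ xs} (fx∉ ∷ d) = (λ x∈ → fx∉ (∈-map⁺ f x∈)) ∷ distinct-map⁻ d

-- Walks, closed trails and cycles

Joins-sym : ∀ {m} (Γ : Graph m) {h u v} → Joins Γ h u v → Joins Γ h v u
Joins-sym Γ (inj₁ e) = inj₂ e
Joins-sym Γ (inj₂ e) = inj₁ e

data Walk {m} (Γ : Graph m) : Fin (V Γ) → List (Fin m) → Fin (V Γ) → Set where
  nil  : ∀ {u} → Walk Γ u [] u
  cons : ∀ {u v w h hs} → Joins Γ h u v → Walk Γ v hs w → Walk Γ u (h ∷ hs) w

In : ∀ {m} → Subset m → Fin m → Set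
In X h = lookup X h ≡ true

module _ {n n′} {X : Subset n} {X′ : Subset n′} {f : Fin n → Fin n′}
         (X′∘f≗X : ∀ i → lookup X′ (f i) ≡ lookup X i) where

  All-In-map⁺ : ∀ {is} → All (In X) is → All (In X′) (map f is)
  All-In-map⁺ ax = All-map⁺ (All.map (λ {i} i∈X → trans (X′∘f≗X i) i∈X) ax)

  All-In-map⁻ : ∀ {is} → All (In X′) (map f is) → All (In X) is
  All-In-map⁻ ax = All.map (λ {i} i∈X′ → trans (sym (X′∘f≗X i)) i∈X′) (All-map⁻ ax)

record ClosedTrail {m} (Γ : Graph m) (X : Subset m) : Set where
  constructor closedTrail
  field
    {start}  : Fin (V Γ)
    edges    : List (Fin m)
    walk     : Walk Γ start edges start
    nonempty : edges ≢ []
    distinct : Distinct edges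
    inX      : All (In X) edges

module _ {m} {Γ : Graph m} where

  _++ʷ_ : ∀ {u v w xs ys} → Walk Γ u xs v → Walk Γ v ys w → Walk Γ u (xs ++ ys) w
  nil       ++ʷ W' = W'
  cons j W  ++ʷ W' = cons j (W ++ʷ W')

  splitWalk : ∀ xs {ys u w} → Walk Γ u (xs ++ ys) w → Σ[ v ∈ Fin (V Γ) ] (Walk Γ u xs v × Walk Γ v ys w)
  splitWalk []       W          = _ , nil , W
  splitWalk (x ∷ xs) (cons j W) with splitWalk xs W
  ... | v , W₁ , W₂ = v , cons j W₁ , W₂

  rotateWalk : ∀ xs {ys u} → Walk Γ u (xs ++ ys) u → Σ[ v ∈ Fin (V Γ) ] Walk Γ v (ys ++ xs) v
  rotateWalk xs W with splitWalk xs W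
  ... | v , W₁ , W₂ = v , (W₂ ++ʷ W₁)

  reverseWalk : ∀ {u w xs} → Walk Γ u xs w → Walk Γ w (reverse xs) u
  reverseWalk nil = nil
  reverseWalk {xs = x ∷ xs} (cons j W) rewrite unfold-reverse x xs = reverseWalk W ++ʷ cons (Joins-sym Γ j) nil

  walk-[] : ∀ {u w} → Walk Γ u [] w → u ≡ w
  walk-[] nil = refl

  vertexAt : ∀ {u w hs} → Walk Γ u hs w → Fin (suc (length hs)) → Fin (V Γ)
  vertexAt {u} W          zero    = u
  vertexAt     (cons j W) (suc i) = vertexAt W i

  joinsAt : ∀ {u w hs} (W : Walk Γ u hs w) (i : Fin (length hs)) →
    Joins Γ (lookupₗ hs i) (vertexAt W (inject₁ i)) (vertexAt W (suc i))
  joinsAt (cons j W) zero    = j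
  joinsAt (cons j W) (suc i) = joinsAt W i

  vertexAt-last : ∀ {u w hs} (W : Walk Γ u hs w) → vertexAt W (fromℕ (length hs)) ≡ w
  vertexAt-last nil        = refl
  vertexAt-last (cons j W) = vertexAt-last W

  walkPrefix : ∀ {u w hs} (W : Walk Γ u hs w) (i : Fin (suc (length hs))) → Walk Γ u (take (toℕ i) hs) (vertexAt W i)
  walkPrefix W          zero    = nil
  walkPrefix (cons j W) (suc i) = cons j (walkPrefix W i)

  -- simple: the vertices other than the last one are distinct.
  data SimpleOrShortcut {u w hs} (W : Walk Γ u hs w) : Set where
    simple   : (∀ {i j} → vertexAt W (inject₁ i) ≡ vertexAt W (inject₁ j) → i ≡ j) → SimpleOrShortcut W
    shortcut : ∀ x sb l r → hs ≡ l ++ sb ++ r → sb ≢ [] → length sb < length hs → Walk Γ x sb x → SimpleOrShortcut W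

  simpleOrShortcut : ∀ {u w hs} (W : Walk Γ u hs w) → SimpleOrShortcut W
  simpleOrShortcut nil = simple (λ { {()} })
  simpleOrShortcut {u} {hs = h ∷ hs} (cons j W) with any? (λ i → vertexAt W (inject₁ i) ≟ u)
  ... | yes (i , returns) =
    shortcut u (h ∷ take k hs) [] (drop k hs) (cong (h ∷_) (sym (take++drop≡id k hs))) (λ ()) shorter
      (cons j (subst (Walk Γ _ _) returns (walkPrefix W (inject₁ i))))
    where
    k = toℕ (inject₁ i)
    shorter : suc (length (take k hs)) < suc (length hs)
    shorter = s≤s (≤-trans (s≤s (subst (_≤ k) (sym (length-take k hs)) (m⊓n≤m _ _)))
                           (subst (_≤ length hs) (cong suc (sym (toℕ-inject₁ i))) (toℕ<n i)))
  ... | no ¬returns with simpleOrShortcut W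
  ...   | simple inj = simple inj′
    where
    inj′ : ∀ {i k : Fin (suc (length hs))} → vertexAt (cons j W) (inject₁ i) ≡ vertexAt (cons j W) (inject₁ k) → i ≡ k
    inj′ {zero}  {zero}  eq = refl
    inj′ {zero}  {suc k} eq = ⊥-elim (¬returns (k , sym eq))
    inj′ {suc i} {zero}  eq = ⊥-elim (¬returns (i , eq))
    inj′ {suc i} {suc k} eq = cong suc (inj eq)
  ...   | shortcut x sb l r eq ne lt W′ = shortcut x sb (h ∷ l) r (cong (h ∷_) eq) ne (≤-trans lt (n≤1+n _)) W′

  next-inject₁ : ∀ {k} (i : Fin (suc k)) → (suc i ≡ inject₁ (next i)) ⊎ ((i ≡ fromℕ k) × (next i ≡ zero))
  next-inject₁ {zero}  zero    = inj₂ (refl , refl)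
  next-inject₁ {suc k} zero    = inj₁ refl
  next-inject₁ {suc k} (suc i) with next {k} i | next-inject₁ {k} i
  ... | zero  | inj₁ ()
  ... | zero  | inj₂ (e , _) = inj₂ (cong suc e , refl)
  ... | suc j | inj₁ e       = inj₁ (cong suc e)
  ... | suc j | inj₂ (_ , ())

  -- Shortcut until the trail is simple; the fuel n bounds the number of edges.
  closedTrail⇒cycle′ : ∀ {X} n {u hs} (W : Walk Γ u hs u) → hs ≢ [] → Distinct hs → All (In X) hs →
    length hs ≤ n → CycleIn Γ X
  closedTrail⇒cycle′ zero {hs = []}    W ne d ax le = ⊥-elim (ne refl)
  closedTrail⇒cycle′ zero {hs = _ ∷ _} W ne d ax ()
  closedTrail⇒cycle′ {X} (suc n) {u} {hs} W ne d ax le with simpleOrShortcut W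
  ... | shortcut x sb l r eq ne′ lt W′ =
    closedTrail⇒cycle′ n W′ ne′ (distinct-infix l (subst Distinct eq d))
      (++⁻ˡ sb (++⁻ʳ l (subst (All (In X)) eq ax))) (≤-pred (≤-trans lt le))
  closedTrail⇒cycle′ {X} (suc n) {u} {[]}       W ne d ax le | simple inj = ⊥-elim (ne refl)
  closedTrail⇒cycle′ {X} (suc n) {u} {h ∷ hs} W ne d ax le | simple inj = record
    { k     = length hs
    ; w     = λ i → vertexAt W (inject₁ i)
    ; c     = lookupₗ (h ∷ hs)
    ; w-inj = inj
    ; c-inj = distinct-lookup-injective d
    ; c∈X   = λ i → lookup⇒[]= (lookupₗ (h ∷ hs) i) X (All.lookup ax (∈-lookup i))
    ; joins = joins
    }
    where
    joins : ∀ i → Joins Γ (lookupₗ (h ∷ hs) i) (vertexAt W (inject₁ i)) (vertexAt W (inject₁ (next i)))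
    joins i with next-inject₁ i
    ... | inj₁ e = subst (Joins Γ _ _) (cong (vertexAt W) e) (joinsAt W i)
    ... | inj₂ (i-last , next-zero) = subst (Joins Γ _ _)
            (trans (cong (vertexAt W ∘ suc) i-last) (trans (vertexAt-last W) (cong (vertexAt W ∘ inject₁) (sym next-zero))))
            (joinsAt W i)

  closedTrail⇒cycle : ∀ {X} → ClosedTrail Γ X → CycleIn Γ X
  closedTrail⇒cycle (closedTrail hs W ne d ax) = closedTrail⇒cycle′ (length hs) W ne d ax ≤-refl

  tabulateWalk : ∀ n (F : Fin (suc n) → Fin (V Γ)) (C : Fin n → Fin m) → (∀ i → Joins Γ (C i) (F (inject₁ i)) (F (suc i)))
    → Walk Γ (F zero) (tabulate C) (F (fromℕ n))
  tabulateWalk zero    F C J = nil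
  tabulateWalk (suc n) F C J = cons (J zero) (tabulateWalk n (F ∘ suc) (C ∘ suc) (J ∘ suc))

  cycle⇒closedTrail : ∀ {X} → CycleIn Γ X → ClosedTrail Γ X
  cycle⇒closedTrail {X} cy =
    closedTrail (tabulate c) W′ (λ ()) (distinct-tabulate c c-inj) (tabulate⁺ (λ i → []=⇒lookup (c∈X i)))
    where
    open CycleIn cy
    F : Fin (suc (suc k)) → Fin (V Γ)
    F zero    = w zero
    F (suc i) = w (next i)
    F-inject₁ : ∀ i → F (inject₁ i) ≡ w i
    F-inject₁ zero    = refl
    F-inject₁ (suc j) with next-inject₁ (inject₁ j)
    ... | inj₁ e       = cong w (sym (inject₁-injective e))
    ... | inj₂ (e , _) = ⊥-elim (fromℕ≢inject₁ (sym e))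
    F-last : F (fromℕ (suc k)) ≡ w zero
    F-last with next-inject₁ (fromℕ k)
    ... | inj₁ e       = ⊥-elim (fromℕ≢inject₁ e)
    ... | inj₂ (_ , e) = cong w e
    W′ : Walk Γ (w zero) (tabulate c) (w zero)
    W′ = subst (Walk Γ (w zero) (tabulate c)) F-last
           (tabulateWalk (suc k) F c (λ i → subst (λ z → Joins Γ (c i) z (w (next i))) (sym (F-inject₁ i)) (joins i)))

  closedTrail-cut : ∀ {X g} (C : ClosedTrail Γ X) → g ∈ ClosedTrail.edges C →
    Σ[ x ∈ Fin (V Γ) ] Σ[ z ∈ Fin (V Γ) ] Σ[ zs ∈ List (Fin m) ]
      (Walk Γ x zs z × Joins Γ g z x × g ∉ zs × Distinct zs × All (In X) zs)
  closedTrail-cut {X} {g} (closedTrail hs W ne d ax) g∈ with ∈-∃++ g∈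
  ... | l , r , hs≡ =
    x , z , r ++ l , W₁ , joins-g , (λ g∈′ → distinct-++-disjoint (r ++ l) d′ g∈′ (here refl)) ,
    distinct-++ˡ (r ++ l) d′ , ++⁻ˡ (r ++ l) ax′
    where
    hs≡′ : hs ≡ (l ++ [ g ]) ++ r
    hs≡′ = trans hs≡ (sym (++-assoc l [ g ] r))
    rotated = rotateWalk (l ++ [ g ]) (subst (λ es → Walk Γ _ es _) hs≡′ W)
    x = proj₁ rotated
    W-rot : Walk Γ x ((r ++ l) ++ [ g ]) x
    W-rot = subst (λ es → Walk Γ x es x) (sym (++-assoc r l [ g ])) (proj₂ rotated)
    split = splitWalk (r ++ l) W-rot
    z = proj₁ split
    W₁ = proj₁ (proj₂ split)
    joins-g : Joins Γ g z x
    joins-g with proj₂ (proj₂ split)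
    ... | cons j nil = j
    d′ : Distinct ((r ++ l) ++ [ g ])
    d′ = subst Distinct (sym (++-assoc r l [ g ])) (distinct-++-comm (l ++ [ g ]) (subst Distinct hs≡′ d))
    ax′ : All (In X) ((r ++ l) ++ [ g ])
    ax′ = subst (All (In X)) (sym (++-assoc r l [ g ]))
            (++⁺ (++⁻ʳ (l ++ [ g ]) (subst (All (In X)) hs≡′ ax)) (++⁻ˡ (l ++ [ g ]) (subst (All (In X)) hs≡′ ax)))

-- Spanning forest polynomials as indicator functions

indicator : ∀ {P : Set} → Dec P → ℚ
indicator (yes _) = 1ℚ
indicator (no  _) = 0ℚ

indicator-¬ : ∀ {P : Set} (P? : Dec P) → ¬ P → indicator P? ≡ 0ℚ
indicator-¬ (yes p) ¬p = ⊥-elim (¬p p)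
indicator-¬ (no  _) ¬p = refl

indicator-⇔ : ∀ {P Q : Set} → P ⇔ Q → (P? : Dec P) (Q? : Dec Q) → indicator P? ≡ indicator Q?
indicator-⇔ P⇔Q (yes p) (yes q) = refl
indicator-⇔ P⇔Q (yes p) (no ¬q) = ⊥-elim (¬q (Equivalence.to P⇔Q p))
indicator-⇔ P⇔Q (no ¬p) (yes q) = ⊥-elim (¬p (Equivalence.from P⇔Q q))
indicator-⇔ P⇔Q (no ¬p) (no ¬q) = refl

indicator-twoSum : ∀ {A B C D : Set} → (B → A) → (D → C) → (A? : Dec A) (B? : Dec B) (C? : Dec C) (D? : Dec D) →
  indicator (A? ×-dec C? ×-dec (B? ⊎-dec D?)) ≡ indicator B? * indicator C? + (indicator A? - indicator B?) * indicator D?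
indicator-twoSum B⇒A D⇒C (no ¬a)  (yes b) _       _       = ⊥-elim (¬a (B⇒A b))
indicator-twoSum B⇒A D⇒C _        _       (no ¬c) (yes d) = ⊥-elim (¬c (D⇒C d))
indicator-twoSum B⇒A D⇒C (yes _)  (yes _) (yes _) (yes _) = refl
indicator-twoSum B⇒A D⇒C (yes _)  (yes _) (yes _) (no _)  = refl
indicator-twoSum B⇒A D⇒C (yes _)  (yes _) (no _)  (no _)  = refl
indicator-twoSum B⇒A D⇒C (yes _)  (no _)  (yes _) (yes _) = refl
indicator-twoSum B⇒A D⇒C (yes _)  (no _)  (yes _) (no _)  = refl
indicator-twoSum B⇒A D⇒C (yes _)  (no _)  (no _)  (no _)  = refl
indicator-twoSum B⇒A D⇒C (no _)   (no _)  (yes _) (yes _) = refl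
indicator-twoSum B⇒A D⇒C (no _)   (no _)  (yes _) (no _)  = refl
indicator-twoSum B⇒A D⇒C (no _)   (no _)  (no _)  (no _)  = refl

sfp-indicator : ∀ {m} (Γ : Graph m) (dec : ∀ X → Dec (Acyclic Γ X)) X → sfp Γ dec X ≡ indicator (dec X)
sfp-indicator Γ dec X with dec X
... | yes _ = refl
... | no  _ = refl

CycleIn-mono : ∀ {m} {Γ : Graph m} {X Y : Subset m} → (∀ {i} → i ∈ₛ X → i ∈ₛ Y) → CycleIn Γ X → CycleIn Γ Y
CycleIn-mono X⊆Y cy = record { CycleIn cy; c∈X = λ i → X⊆Y (CycleIn.c∈X cy i) }

insertAt-false⊆true : ∀ {n} (X : Subset n) g {i} → i ∈ₛ insertAtᵥ X g false → i ∈ₛ insertAtᵥ X g true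
insertAt-false⊆true X       zero    (there i∈) = there i∈
insertAt-false⊆true (x ∷ X) (suc g) here       = here
insertAt-false⊆true (x ∷ X) (suc g) (there i∈) = there (insertAt-false⊆true X g i∈)

Acyclic-insertAt : ∀ {m} (Γ : Graph (suc m)) X g → Acyclic Γ (insertAtᵥ X g true) → Acyclic Γ (insertAtᵥ X g false)
Acyclic-insertAt Γ X g acyclic = acyclic ∘ CycleIn-mono (insertAt-false⊆true X g)

loop-cycle : ∀ {m} (Γ : Graph m) {X : Subset m} {g} → proj₁ (ends Γ g) ≡ proj₂ (ends Γ g) → g ∈ₛ X → CycleIn Γ X
loop-cycle Γ {g = g} loop g∈X = record
  { k = 0 ; w = λ _ → u ; c = λ _ → g
  ; w-inj = λ { {zero} {zero} _ → refl } ; c-inj = λ { {zero} {zero} _ → refl }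
  ; c∈X = λ _ → g∈X ; joins = λ _ → inj₁ (cong (u ,_) (sym loop)) }
  where u = proj₁ (ends Γ g)

∂-sfp-loop : ∀ {m} (Γ : Graph m) dec {g} → proj₁ (ends Γ g) ≡ proj₂ (ends Γ g) → ∀ X → ∂ g (sfp Γ dec) X ≡ 0ℚ
∂-sfp-loop Γ dec {g} loop X with lookup X g
... | true  = refl
... | false = trans (sfp-indicator Γ dec _) (indicator-¬ (dec _) (λ acyclic → acyclic (loop-cycle Γ loop ([]≔-updates X g))))

-- Cycles of a two-sum


OneOf : ∀ {n} → Fin n → Fin n → Fin n → Set
OneOf S T x = (x ≡ S) ⊎ (x ≡ T)

oneOf-third : ∀ {n} {S T x y z : Fin n} → OneOf S T x → OneOf S T y → OneOf S T z → x ≢ y → z ≢ y → x ≡ z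
oneOf-third (inj₁ refl) (inj₁ refl) _ n₁ n₂ = ⊥-elim (n₁ refl)
oneOf-third (inj₁ refl) (inj₂ refl) (inj₁ refl) n₁ n₂ = refl
oneOf-third (inj₁ refl) (inj₂ refl) (inj₂ refl) n₁ n₂ = ⊥-elim (n₂ refl)
oneOf-third (inj₂ refl) (inj₁ refl) (inj₁ refl) n₁ n₂ = ⊥-elim (n₂ refl)
oneOf-third (inj₂ refl) (inj₁ refl) (inj₂ refl) n₁ n₂ = refl
oneOf-third (inj₂ refl) (inj₂ refl) _ n₁ n₂ = ⊥-elim (n₁ refl)

oneOf-≢ : ∀ {n} {S T x y : Fin n} → OneOf S T x → OneOf S T y → x ≢ y → ((x ≡ S) × (y ≡ T)) ⊎ ((x ≡ T) × (y ≡ S))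
oneOf-≢ (inj₁ refl) (inj₁ refl) n = ⊥-elim (n refl)
oneOf-≢ (inj₁ e) (inj₂ f) n = inj₁ (e , f)
oneOf-≢ (inj₂ e) (inj₁ f) n = inj₂ (e , f)
oneOf-≢ (inj₂ refl) (inj₂ refl) n = ⊥-elim (n refl)

oneOf-collapse : ∀ {n} {S T x y : Fin n} → S ≡ T → OneOf S T x → OneOf S T y → x ≡ y
oneOf-collapse refl (inj₁ refl) (inj₁ refl) = refl
oneOf-collapse refl (inj₁ refl) (inj₂ refl) = refl
oneOf-collapse refl (inj₂ refl) (inj₁ refl) = refl
oneOf-collapse refl (inj₂ refl) (inj₂ refl) = refl

,-injective : ∀ {A B : Set} {x y : A} {x′ y′ : B} → (x , x′) ≡ (y , y′) → (x ≡ y) × (x′ ≡ y′)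
,-injective refl = refl , refl

end₁ end₂ : ∀ {m} (Γ : Graph m) → Fin m → Bool → Fin (V Γ)
end₁ Γ h fl = if fl then proj₂ (ends Γ h) else proj₁ (ends Γ h)
end₂ Γ h fl = if fl then proj₁ (ends Γ h) else proj₂ (ends Γ h)

module _ {m} (Γ : Graph m) (h : Fin m) where

  joins-ends : ∀ fl → Joins Γ h (end₁ Γ h fl) (end₂ Γ h fl)
  joins-ends true  = inj₂ refl
  joins-ends false = inj₁ refl

  joins⇒ends : ∀ fl {u w} → Joins Γ h u w → OneOf (end₁ Γ h fl) (end₂ Γ h fl) u × OneOf (end₁ Γ h fl) (end₂ Γ h fl) w
  joins⇒ends false (inj₁ e) = let (e₁ , e₂) = ,-injective e in inj₁ (sym e₁) , inj₂ (sym e₂)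
  joins⇒ends true  (inj₁ e) = let (e₁ , e₂) = ,-injective e in inj₂ (sym e₁) , inj₁ (sym e₂)
  joins⇒ends false (inj₂ e) = let (e₁ , e₂) = ,-injective e in inj₂ (sym e₂) , inj₁ (sym e₁)
  joins⇒ends true  (inj₂ e) = let (e₁ , e₂) = ,-injective e in inj₁ (sym e₂) , inj₂ (sym e₁)

  ends⇒joins : ∀ fl {u w} → OneOf (end₁ Γ h fl) (end₂ Γ h fl) u → OneOf (end₁ Γ h fl) (end₂ Γ h fl) w →
    u ≢ w → Joins Γ h u w
  ends⇒joins fl u∈ w∈ u≢w with oneOf-≢ u∈ w∈ u≢w
  ... | inj₁ (refl , refl) = joins-ends fl
  ... | inj₂ (refl , refl) = Joins-sym Γ (joins-ends fl)

  loop⇒ends≡ : ∀ fl {v} → Joins Γ h v v → end₁ Γ h fl ≡ end₂ Γ h fl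
  loop⇒ends≡ fl {v} loop = loop-ends fl (case loop of λ { (inj₁ e) → e ; (inj₂ e) → e })
    where
    loop-ends : ∀ fl → ends Γ h ≡ (v , v) → end₁ Γ h fl ≡ end₂ Γ h fl
    loop-ends false e = let (e₁ , e₂) = ,-injective e in trans e₁ (sym e₂)
    loop-ends true  e = let (e₁ , e₂) = ,-injective e in trans e₂ (sym e₁)

module _ {a b} (ℋ : Graph (suc a)) (gH : Fin (suc a)) (𝒦 : Graph (suc b)) (gK : Fin (suc b)) (flip : Bool) where
  𝒢 = twoSum ℋ gH 𝒦 gK flip
  VH = V ℋ
  VK = V 𝒦
  s t : Fin VH
  s = end₁ ℋ gH flip
  t = end₂ ℋ gH flip
  p q : Fin VK
  p = end₁ 𝒦 gK false
  q = end₂ 𝒦 gK false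
  edgH : Fin a → Fin (a +ℕ b)
  edgH i = i ↑ˡ b
  edgK : Fin b → Fin (a +ℕ b)
  edgK j = a ↑ʳ j
  ιH : Fin a → Fin (suc a)
  ιH = punchIn gH
  ιK : Fin b → Fin (suc b)
  ιK = punchIn gK

  -- The vertex maps of twoSum, repeated so that ends-edgH and ends-edgK hold by computation.
  vtxH : Fin VH → Fin (VH +ℕ VK)
  vtxH u = u ↑ˡ VK
  vtxK : Fin VK → Fin (VH +ℕ VK)
  vtxK v with v ≟ p
  ... | yes _ = vtxH s
  ... | no  _ with v ≟ q
  ...   | yes _ = vtxH t
  ...   | no  _ = VH ↑ʳ v

  ends-edgH : ∀ i → ends 𝒢 (i ↑ˡ b) ≡ (vtxH (proj₁ (ends ℋ (punchIn gH i))) , vtxH (proj₂ (ends ℋ (punchIn gH i))))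
  ends-edgH i rewrite splitAt-↑ˡ a i b = refl

  ends-edgK : ∀ j → ends 𝒢 (a ↑ʳ j) ≡ (vtxK (proj₁ (ends 𝒦 (punchIn gK j))) , vtxK (proj₂ (ends 𝒦 (punchIn gK j))))
  ends-edgK j rewrite splitAt-↑ʳ a b j with proj₁ (ends 𝒦 (punchIn gK j)) | proj₂ (ends 𝒦 (punchIn gK j))
  ... | x | y with x ≟ p | y ≟ p
  ... | yes _ | yes _ = refl
  ... | yes _ | no _ with y ≟ q
  ...   | yes _ = refl
  ...   | no  _ = refl
  ends-edgK j | x | y | no _ | yes _ with x ≟ q
  ...   | yes _ = refl
  ...   | no  _ = refl
  ends-edgK j | x | y | no _ | no _ with x ≟ q | y ≟ q
  ...   | yes _ | yes _ = refl
  ...   | yes _ | no  _ = refl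
  ...   | no  _ | yes _ = refl
  ...   | no  _ | no  _ = refl

  vtxH-injective : ∀ {x y} → vtxH x ≡ vtxH y → x ≡ y
  vtxH-injective {x} {y} = ↑ˡ-injective VK x y

  vtxH≢↑ʳ : ∀ {x : Fin VH} {z : Fin VK} → vtxH x ≢ VH ↑ʳ z
  vtxH≢↑ʳ {x} {z} e with trans (sym (splitAt-↑ˡ VH x VK)) (trans (cong (splitAt VH) e) (splitAt-↑ʳ VH VK z))
  ... | ()

  data VtxKView (z : Fin VK) : Set where
    at-p : z ≡ p → vtxK z ≡ vtxH s → VtxKView z
    at-q : z ≡ q → z ≢ p → vtxK z ≡ vtxH t → VtxKView z
    fresh : z ≢ p → z ≢ q → vtxK z ≡ VH ↑ʳ z → VtxKView z

  vtxK-at-p : ∀ {z} → z ≡ p → vtxK z ≡ vtxH s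
  vtxK-at-p {z} z≡p with z ≟ p
  ... | yes _   = refl
  ... | no z≢p = ⊥-elim (z≢p z≡p)

  vtxK-at-q : ∀ {z} → z ≢ p → z ≡ q → vtxK z ≡ vtxH t
  vtxK-at-q {z} z≢p z≡q with z ≟ p
  ... | yes z≡p = ⊥-elim (z≢p z≡p)
  ... | no _ with z ≟ q
  ...   | yes _   = refl
  ...   | no z≢q = ⊥-elim (z≢q z≡q)

  vtxK-fresh : ∀ {z} → z ≢ p → z ≢ q → vtxK z ≡ VH ↑ʳ z
  vtxK-fresh {z} z≢p z≢q with z ≟ p
  ... | yes z≡p = ⊥-elim (z≢p z≡p)
  ... | no _ with z ≟ q
  ...   | yes z≡q = ⊥-elim (z≢q z≡q)
  ...   | no _    = refl

  vtxK-view : ∀ z → VtxKView z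
  vtxK-view z with z ≟ p | z ≟ q
  ... | yes z≡p | _       = at-p z≡p (vtxK-at-p z≡p)
  ... | no z≢p  | yes z≡q = at-q z≡q z≢p (vtxK-at-q z≢p z≡q)
  ... | no z≢p  | no z≢q  = fresh z≢p z≢q (vtxK-fresh z≢p z≢q)

  EndK : Fin VK → Set
  EndK = OneOf p q

  vtxK≡vtxH : ∀ {z x} → vtxK z ≡ vtxH x → EndK z × OneOf s t x
  vtxK≡vtxH {z} e with vtxK-view z
  ... | at-p e₁ e₂ = inj₁ e₁ , inj₁ (vtxH-injective (trans (sym e) e₂))
  ... | at-q e₁ _ e₂ = inj₂ e₁ , inj₂ (vtxH-injective (trans (sym e) e₂))
  ... | fresh _ _ e₂ = ⊥-elim (vtxH≢↑ʳ (trans (sym e) e₂))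

  vtxH-end : ∀ {u} → OneOf s t u → OneOf (vtxH s) (vtxH t) (vtxH u)
  vtxH-end = map-⊎ (cong vtxH) (cong vtxH)

  vtxK-end : ∀ {z} → EndK z → OneOf (vtxH s) (vtxH t) (vtxK z)
  vtxK-end {z} pz with vtxK-view z
  ... | at-p _ e = inj₁ e
  ... | at-q _ _ e = inj₂ e
  ... | fresh n₁ n₂ _ = ⊥-elim ([ n₁ , n₂ ]′ pz)

  vtxK-glued : ∀ {z z'} → vtxK z ≡ vtxK z' → (z ≡ z') ⊎ (EndK z × EndK z' × s ≡ t)
  vtxK-glued {z} {z'} e with vtxK-view z | vtxK-view z'
  ... | fresh _ _ e₁ | fresh _ _ e₂ = inj₁ (↑ʳ-injective VH z z' (trans (sym e₁) (trans e e₂)))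
  ... | fresh _ _ e₁ | at-p _ e₂ = ⊥-elim (vtxH≢↑ʳ (sym (trans (sym e₁) (trans e e₂))))
  ... | fresh _ _ e₁ | at-q _ _ e₂ = ⊥-elim (vtxH≢↑ʳ (sym (trans (sym e₁) (trans e e₂))))
  ... | at-p _ e₁ | fresh _ _ e₂ = ⊥-elim (vtxH≢↑ʳ (trans (sym e₁) (trans e e₂)))
  ... | at-q _ _ e₁ | fresh _ _ e₂ = ⊥-elim (vtxH≢↑ʳ (trans (sym e₁) (trans e e₂)))
  ... | at-p e₁ _ | at-p e₂ _ = inj₁ (trans e₁ (sym e₂))
  ... | at-q e₁ _ _ | at-q e₂ _ _ = inj₁ (trans e₁ (sym e₂))
  ... | at-p e₁ f₁ | at-q e₂ _ f₂ = inj₂ (inj₁ e₁ , inj₂ e₂ , vtxH-injective (trans (sym f₁) (trans e f₂)))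
  ... | at-q e₁ _ f₁ | at-p e₂ f₂ = inj₂ (inj₂ e₁ , inj₁ e₂ , vtxH-injective (trans (sym f₂) (trans (sym e) f₁)))

  gH-ends : ∀ {u w} → Joins ℋ gH u w → OneOf s t u × OneOf s t w
  gH-ends = joins⇒ends ℋ gH flip

  gK-ends : ∀ {u w} → Joins 𝒦 gK u w → EndK u × EndK w
  gK-ends = joins⇒ends 𝒦 gK false

  joins-edgH : ∀ {i x y} → Joins ℋ (punchIn gH i) x y → Joins 𝒢 (i ↑ˡ b) (vtxH x) (vtxH y)
  joins-edgH {i} (inj₁ e) = inj₁ (trans (ends-edgH i) (cong (λ z → vtxH (proj₁ z) , vtxH (proj₂ z)) e))
  joins-edgH {i} (inj₂ e) = inj₂ (trans (ends-edgH i) (cong (λ z → vtxH (proj₁ z) , vtxH (proj₂ z)) e))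

  joins-edgK : ∀ {j x y} → Joins 𝒦 (punchIn gK j) x y → Joins 𝒢 (a ↑ʳ j) (vtxK x) (vtxK y)
  joins-edgK {j} (inj₁ e) = inj₁ (trans (ends-edgK j) (cong (λ z → vtxK (proj₁ z) , vtxK (proj₂ z)) e))
  joins-edgK {j} (inj₂ e) = inj₂ (trans (ends-edgK j) (cong (λ z → vtxK (proj₁ z) , vtxK (proj₂ z)) e))

  joins-edgH⁻ : ∀ {i u v x} → Joins 𝒢 (i ↑ˡ b) u v → vtxH x ≡ u →
    Σ[ y ∈ Fin VH ] (vtxH y ≡ v × Joins ℋ (punchIn gH i) x y)
  joins-edgH⁻ {i} (inj₁ e) ex with ,-injective (trans (sym (ends-edgH i)) e)
  ... | e₁ , e₂ = proj₂ (ends ℋ (punchIn gH i)) , e₂ , inj₁ (cong (_, _) (vtxH-injective (trans e₁ (sym ex))))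
  joins-edgH⁻ {i} (inj₂ e) ex with ,-injective (trans (sym (ends-edgH i)) e)
  ... | e₁ , e₂ = proj₁ (ends ℋ (punchIn gH i)) , e₁ , inj₂ (cong (_ ,_) (vtxH-injective (trans e₂ (sym ex))))

  joins-edgH-from : ∀ {i u v} → Joins 𝒢 (i ↑ˡ b) u v → Σ[ x ∈ Fin VH ] (vtxH x ≡ u)
  joins-edgH-from {i} (inj₁ e) = _ , proj₁ (,-injective (trans (sym (ends-edgH i)) e))
  joins-edgH-from {i} (inj₂ e) = _ , proj₂ (,-injective (trans (sym (ends-edgH i)) e))

  joins-edgK-lift : ∀ {j u v} → Joins 𝒢 (a ↑ʳ j) u v →
    Σ[ x ∈ Fin VK ] Σ[ y ∈ Fin VK ] (vtxK x ≡ u × vtxK y ≡ v × Joins 𝒦 (punchIn gK j) x y)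
  joins-edgK-lift {j} (inj₁ e) with ,-injective (trans (sym (ends-edgK j)) e)
  ... | e₁ , e₂ = _ , _ , e₁ , e₂ , inj₁ refl
  joins-edgK-lift {j} (inj₂ e) with ,-injective (trans (sym (ends-edgK j)) e)
  ... | e₁ , e₂ = _ , _ , e₂ , e₁ , inj₂ refl

  joins-edgK⁻ : ∀ {j u v x} → Joins 𝒢 (a ↑ʳ j) u v → vtxK x ≡ u →
    (Σ[ y ∈ Fin VK ] (vtxK y ≡ v × Joins 𝒦 (punchIn gK j) x y)) ⊎ (EndK x × s ≡ t)
  joins-edgK⁻ {j} {u} {v} {x} (inj₁ e) ex with ,-injective (trans (sym (ends-edgK j)) e) | proj₁ (ends 𝒦 (punchIn gK j)) ≟ x
  ... | e₁ , e₂ | yes k = inj₁ (proj₂ (ends 𝒦 (punchIn gK j)) , e₂ , inj₁ (cong (_, proj₂ (ends 𝒦 (punchIn gK j))) k))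
  ... | e₁ , e₂ | no k with vtxK-glued (trans e₁ (sym ex))
  ...   | inj₁ kk = ⊥-elim (k kk)
  ...   | inj₂ (_ , px , st) = inj₂ (px , st)
  joins-edgK⁻ {j} {u} {v} {x} (inj₂ e) ex with ,-injective (trans (sym (ends-edgK j)) e) | proj₂ (ends 𝒦 (punchIn gK j)) ≟ x
  ... | e₁ , e₂ | yes k = inj₁ (proj₁ (ends 𝒦 (punchIn gK j)) , e₁ , inj₂ (cong (proj₁ (ends 𝒦 (punchIn gK j)) ,_) k))
  ... | e₁ , e₂ | no k with vtxK-glued (trans e₂ (sym ex))
  ...   | inj₁ kk = ⊥-elim (k kk)
  ...   | inj₂ (_ , px , st) = inj₂ (px , st)

  walkH⇒G : ∀ {x y} is → Walk ℋ x (map ιH is) y → Walk 𝒢 (vtxH x) (map edgH is) (vtxH y)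
  walkH⇒G [] nil = nil
  walkH⇒G (i ∷ is) (cons joins W) = cons (joins-edgH joins) (walkH⇒G is W)

  walkK⇒G : ∀ {x y} js → Walk 𝒦 x (map ιK js) y → Walk 𝒢 (vtxK x) (map edgK js) (vtxK y)
  walkK⇒G [] nil = nil
  walkK⇒G (j ∷ js) (cons joins W) = cons (joins-edgK joins) (walkK⇒G js W)

  walkG⇒H : ∀ {u w x} is → Walk 𝒢 u (map edgH is) w → vtxH x ≡ u →
    Σ[ y ∈ Fin VH ] (vtxH y ≡ w × Walk ℋ x (map ιH is) y)
  walkG⇒H [] nil e = _ , e , nil
  walkG⇒H (i ∷ is) (cons j W) e with joins-edgH⁻ j e
  ... | y , e' , jH with walkG⇒H is W e'
  ...   | z , e'' , WH = z , e'' , cons jH WH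

  -- A G-walk along K-edges lifts to K, except that it may jump between p and q at the vertex s = t.
  data LiftK {u w : Fin (VH +ℕ VK)} (x : Fin VK) (js : List (Fin b)) : Set where
    lifted : ∀ y → vtxK y ≡ w → Walk 𝒦 x (map ιK js) y → LiftK x js
    glued : ∀ js₁ js₂ y v → js ≡ js₁ ++ js₂ → Walk 𝒦 x (map ιK js₁) y → vtxK y ≡ v →
             Walk 𝒢 u (map edgK js₁) v → Walk 𝒢 v (map edgK js₂) w → EndK y → s ≡ t → LiftK x js

  liftWalkK : ∀ {u w x} js → Walk 𝒢 u (map edgK js) w → vtxK x ≡ u → LiftK {u} {w} x js
  liftWalkK {x = x} [] nil e = lifted x e nil
  liftWalkK {u} {x = x} (j ∷ js) (cons jn W) e with joins-edgK⁻ jn e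
  ... | inj₂ (px , st) = glued [] (j ∷ js) x u refl nil e nil (cons jn W) px st
  ... | inj₁ (y , e' , jK) with liftWalkK js W e'
  ...   | lifted z ez WK = lifted z ez (cons jK WK)
  ...   | glued js₁ js₂ z v eq WK ez WG₁ WG₂ pz st = glued (j ∷ js₁) js₂ z v (cong (j ∷_) eq) (cons jK WK) ez (cons jn WG₁) WG₂ pz st

  data LiftKFrom {u w : Fin (VH +ℕ VK)} (x : Fin VK) (js : List (Fin b)) : Set where
    liftedFrom : ∀ y → vtxK y ≡ w → Walk 𝒦 x (map ιK js) y → LiftKFrom x js
    gluedFrom : ∀ js₁ js₂ y v → js ≡ js₁ ++ js₂ → js₁ ≢ [] → Walk 𝒦 x (map ιK js₁) y → vtxK y ≡ v →
             Walk 𝒢 u (map edgK js₁) v → Walk 𝒢 v (map edgK js₂) w → EndK y → s ≡ t → LiftKFrom x js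

  liftWalkKFrom : ∀ {u w} j js → Walk 𝒢 u (map edgK (j ∷ js)) w →
    Σ[ x ∈ Fin VK ] (vtxK x ≡ u × LiftKFrom {u} {w} x (j ∷ js))
  liftWalkKFrom j js (cons jn W) with joins-edgK-lift jn
  ... | x , y , ex , ey , jK with liftWalkK js W ey
  ...   | lifted z ez WK = x , ex , liftedFrom z ez (cons jK WK)
  ...   | glued js₁ js₂ z v eq WK ez WG₁ WG₂ pz st =
            x , ex , gluedFrom (j ∷ js₁) js₂ z v (cong (j ∷_) eq) (λ ()) (cons jK WK) ez (cons jn WG₁) WG₂ pz st

  edgH≢edgK : ∀ {i j} → edgH i ≢ edgK j
  edgH≢edgK {i} {j} e with trans (sym (splitAt-↑ˡ a i b)) (trans (cong (splitAt a) e) (splitAt-↑ʳ a b j))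
  ... | ()

  edge-view : ∀ h → (Σ[ i ∈ Fin a ] (h ≡ edgH i)) ⊎ (Σ[ j ∈ Fin b ] (h ≡ edgK j))
  edge-view h with splitAt a h in eq
  ... | inj₁ i = inj₁ (i , sym (splitAt⁻¹-↑ˡ eq))
  ... | inj₂ j = inj₂ (j , sym (splitAt⁻¹-↑ʳ eq))

  findKH : ∀ (hs : List (Fin (a +ℕ b))) →
    (Σ[ l₁ ∈ List (Fin (a +ℕ b)) ] Σ[ j₀ ∈ Fin b ] Σ[ i₁ ∈ Fin a ] Σ[ l₂ ∈ List (Fin (a +ℕ b)) ]
       (hs ≡ l₁ ++ edgK j₀ ∷ edgH i₁ ∷ l₂))
    ⊎ (Σ[ is ∈ List (Fin a) ] Σ[ js ∈ List (Fin b) ] (hs ≡ map edgH is ++ map edgK js))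
  findKH [] = inj₂ ([] , [] , refl)
  findKH (h ∷ hs) with edge-view h | findKH hs
  ... | inj₁ (i , refl) | inj₁ (l₁ , j0 , i₁ , l₂ , eq) = inj₁ (edgH i ∷ l₁ , j0 , i₁ , l₂ , cong (edgH i ∷_) eq)
  ... | inj₁ (i , refl) | inj₂ (is , js , eq) = inj₂ (i ∷ is , js , cong (edgH i ∷_) eq)
  ... | inj₂ (j , refl) | inj₁ (l₁ , j0 , i₁ , l₂ , eq) = inj₁ (edgK j ∷ l₁ , j0 , i₁ , l₂ , cong (edgK j ∷_) eq)
  ... | inj₂ (j , refl) | inj₂ ([] , js , eq) = inj₂ ([] , j ∷ js , cong (edgK j ∷_) eq)
  ... | inj₂ (j , refl) | inj₂ (i ∷ is , js , eq) = inj₁ ([] , j , i , map edgH is ++ map edgK js , cong (edgK j ∷_) eq)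

  spanH : ∀ zs jl → Σ[ is′ ∈ List (Fin a) ] Σ[ j′ ∈ Fin b ] Σ[ r′ ∈ List (Fin (a +ℕ b)) ]
    (zs ++ [ edgK jl ] ≡ map edgH is′ ++ edgK j′ ∷ r′)
  spanH [] jl = [] , jl , [] , refl
  spanH (z ∷ zs) jl with edge-view z | spanH zs jl
  ... | inj₁ (i , refl) | (is' , j' , r' , eq) = i ∷ is' , j' , r' , cong (edgH i ∷_) eq
  ... | inj₂ (j , refl) | _ = [] , j , zs ++ [ edgK jl ] , refl

  StartsInH : List (Fin (a +ℕ b)) → Set
  StartsInH rest = (rest ≡ []) ⊎ (Σ[ i ∈ Fin a ] Σ[ r' ∈ List (Fin (a +ℕ b)) ] (rest ≡ edgH i ∷ r'))

  spanK : ∀ xs → Σ[ js ∈ List (Fin b) ] Σ[ rest ∈ List (Fin (a +ℕ b)) ] ((xs ≡ map edgK js ++ rest) × StartsInH rest)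
  spanK [] = [] , [] , refl , inj₁ refl
  spanK (x ∷ xs) with edge-view x | spanK xs
  ... | inj₁ (i , refl) | _ = [] , edgH i ∷ xs , refl , inj₂ (i , xs , refl)
  ... | inj₂ (j , refl) | (js , rest , eq , rc) = j ∷ js , rest , cong (edgK j ∷_) eq , rc

  spanHK : ∀ zs j₀ → Σ[ is ∈ List (Fin a) ] Σ[ j ∈ Fin b ] Σ[ js ∈ List (Fin b) ] Σ[ rest ∈ List (Fin (a +ℕ b)) ]
    ((zs ++ [ edgK j₀ ] ≡ map edgH is ++ map edgK (j ∷ js) ++ rest) × StartsInH rest)
  spanHK zs j₀ with spanH zs j₀
  ... | is , j , r , span-H with spanK r
  ... | js , rest , span-K , starts-in-H =
    is , j , js , rest , trans span-H (cong (λ es → map edgH is ++ edgK j ∷ es) span-K) , starts-in-H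

  startH : ∀ {u w} is → is ≢ [] → Walk 𝒢 u (map edgH is) w → Σ[ x ∈ Fin VH ] (vtxH x ≡ u)
  startH [] ne _ = ⊥-elim (ne refl)
  startH (i ∷ is) ne (cons j W) = joins-edgH-from j

  startK : ∀ {u w} js → js ≢ [] → Walk 𝒢 u (map edgK js) w → Σ[ x ∈ Fin VK ] (vtxK x ≡ u)
  startK [] ne _ = ⊥-elim (ne refl)
  startK (i ∷ is) ne (cons j W) with joins-edgK-lift j
  ... | x , _ , ex , _ = x , ex

  endK : ∀ {u w} js → js ≢ [] → Walk 𝒢 u (map edgK js) w → Σ[ z ∈ Fin VK ] (vtxK z ≡ w)
  endK []            js≢[] _                = ⊥-elim (js≢[] refl)
  endK (j ∷ [])      _     (cons joins nil) with joins-edgK-lift joins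
  ... | _ , z , _ , z↦w , _ = z , z↦w
  endK (j ∷ j′ ∷ js) _     (cons _ W)       = endK (j′ ∷ js) (λ ()) W

  startsInH-vtx : ∀ {v₃ v₁ x₁} rest → StartsInH rest → Walk 𝒢 v₃ rest v₁ → vtxH x₁ ≡ v₁ →
    Σ[ x₃ ∈ Fin VH ] (vtxH x₃ ≡ v₃)
  startsInH-vtx {x₁ = x₁} [] _ W e = x₁ , trans e (sym (walk-[] W))
  startsInH-vtx (r ∷ rs) (inj₁ ()) W e
  startsInH-vtx (r ∷ rs) (inj₂ (i , r' , refl)) (cons j W) e = joins-edgH-from j

  module Cycles (XH : Subset a) (XK : Subset b) where
    X = XH ++ᵥ XK
    XH⁰ = insertAtᵥ XH gH false
    XH¹ = insertAtᵥ XH gH true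
    XK⁰ = insertAtᵥ XK gK false
    XK¹ = insertAtᵥ XK gK true

    inH⁺ : ∀ {is} → All (In XH) is → All (In X) (map edgH is)
    inH⁺ = All-In-map⁺ {X = XH} {X} (lookup-++ˡ XH XK)
    inH⁻ : ∀ {is} → All (In X) (map edgH is) → All (In XH) is
    inH⁻ = All-In-map⁻ {X = XH} {X} (lookup-++ˡ XH XK)
    inK⁺ : ∀ {js} → All (In XK) js → All (In X) (map edgK js)
    inK⁺ = All-In-map⁺ {X = XK} {X} (lookup-++ʳ XH XK)
    inK⁻ : ∀ {js} → All (In X) (map edgK js) → All (In XK) js
    inK⁻ = All-In-map⁻ {X = XK} {X} (lookup-++ʳ XH XK)
    inιH⁺ : ∀ β {is} → All (In XH) is → All (In (insertAtᵥ XH gH β)) (map ιH is)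
    inιH⁺ β = All-In-map⁺ {X = XH} {insertAtᵥ XH gH β} (insertAt-punchIn XH gH β)
    inιH⁻ : ∀ β {is} → All (In (insertAtᵥ XH gH β)) (map ιH is) → All (In XH) is
    inιH⁻ β = All-In-map⁻ {X = XH} {insertAtᵥ XH gH β} (insertAt-punchIn XH gH β)
    inιK⁺ : ∀ β {js} → All (In XK) js → All (In (insertAtᵥ XK gK β)) (map ιK js)
    inιK⁺ β = All-In-map⁺ {X = XK} {insertAtᵥ XK gK β} (insertAt-punchIn XK gK β)
    inιK⁻ : ∀ β {js} → All (In (insertAtᵥ XK gK β)) (map ιK js) → All (In XK) js
    inιK⁻ β = All-In-map⁻ {X = XK} {insertAtᵥ XK gK β} (insertAt-punchIn XK gK β)

    distinct-edgH : ∀ {is} → Distinct is → Distinct (map edgH is)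
    distinct-edgH = distinct-map edgH (λ {x} {y} → ↑ˡ-injective b x y)
    distinct-edgK : ∀ {js} → Distinct js → Distinct (map edgK js)
    distinct-edgK = distinct-map edgK (λ {x} {y} → ↑ʳ-injective a x y)
    distinct-ιH : ∀ {is} → Distinct is → Distinct (map ιH is)
    distinct-ιH = distinct-map ιH (λ {x} {y} → punchIn-injective gH x y)
    distinct-ιK : ∀ {js} → Distinct js → Distinct (map ιK js)
    distinct-ιK = distinct-map ιK (λ {x} {y} → punchIn-injective gK x y)

    gH∉XH⁰ : ¬ In XH⁰ gH
    gH∉XH⁰ gH∈ with () ← trans (sym gH∈) (insertAt-lookup XH gH false)
    gK∉XK⁰ : ¬ In XK⁰ gK
    gK∉XK⁰ gK∈ with () ← trans (sym gK∈) (insertAt-lookup XK gK false)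

    gH∉ιH : ∀ is → gH ∉ map ιH is
    gH∉ιH is m = let (i , _ , e) = ∈-map⁻ ιH m in punchInᵢ≢i gH i (sym e)
    gK∉ιK : ∀ js → gK ∉ map ιK js
    gK∉ιK js m = let (i , _ , e) = ∈-map⁻ ιK m in punchInᵢ≢i gK i (sym e)

    trailH⁰ : ∀ {x} is → is ≢ [] → Walk ℋ x (map ιH is) x → Distinct is → All (In XH) is → ClosedTrail ℋ XH⁰
    trailH⁰ is ne W d ax = closedTrail (map ιH is) W (map-≢[] ne) (distinct-ιH d) (inιH⁺ false ax)
    trailK⁰ : ∀ {x} js → js ≢ [] → Walk 𝒦 x (map ιK js) x → Distinct js → All (In XK) js → ClosedTrail 𝒦 XK⁰
    trailK⁰ js ne W d ax = closedTrail (map ιK js) W (map-≢[] ne) (distinct-ιK d) (inιK⁺ false ax)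
    trailH¹ : ∀ {x y} is → Walk ℋ x (map ιH is) y → Joins ℋ gH y x → Distinct is → All (In XH) is → ClosedTrail ℋ XH¹
    trailH¹ is W j d ax = closedTrail (map ιH is ++ [ gH ]) (W ++ʷ (cons j nil)) (∷ʳ-≢[] (map ιH is))
      (distinct-∷ʳ (distinct-ιH d) (gH∉ιH is)) (++⁺ (inιH⁺ true ax) (insertAt-lookup XH gH true ∷ []))
    trailK¹ : ∀ {x y} js → Walk 𝒦 x (map ιK js) y → Joins 𝒦 gK y x → Distinct js → All (In XK) js →
      ClosedTrail 𝒦 XK¹
    trailK¹ js W j d ax = closedTrail (map ιK js ++ [ gK ]) (W ++ʷ (cons j nil)) (∷ʳ-≢[] (map ιK js))
      (distinct-∷ʳ (distinct-ιK d) (gK∉ιK js)) (++⁺ (inιK⁺ true ax) (insertAt-lookup XK gK true ∷ []))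
    loop-trailH¹ : s ≡ t → ClosedTrail ℋ XH¹
    loop-trailH¹ st = closedTrail [ gH ] (cons (subst (Joins ℋ gH s) (sym st) (joins-ends ℋ gH flip)) nil) (λ ())
      ((λ ()) ∷ []) (insertAt-lookup XH gH true ∷ [])

    trailH⇒G : ∀ {β} (c : ClosedTrail ℋ (insertAtᵥ XH gH β)) → gH ∉ ClosedTrail.edges c → ClosedTrail 𝒢 X
    trailH⇒G {β} (closedTrail hs W ne d ax) gH∉ with unpunchIn gH hs gH∉
    ... | is , refl = closedTrail (map edgH is) (walkH⇒G is W) (λ e → ne (map-[] _ e))
                        (distinct-edgH (distinct-map⁻ ιH d)) (inH⁺ (inιH⁻ β ax))

    trailK⇒G : ∀ {β} (c : ClosedTrail 𝒦 (insertAtᵥ XK gK β)) → gK ∉ ClosedTrail.edges c → ClosedTrail 𝒢 X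
    trailK⇒G {β} (closedTrail hs W ne d ax) gK∉ with unpunchIn gK hs gK∉
    ... | js , refl = closedTrail (map edgK js) (walkK⇒G js W) (λ e → ne (map-[] _ e))
                        (distinct-edgK (distinct-map⁻ ιK d)) (inK⁺ (inιK⁻ β ax))

    trailH⁰⇒G : ClosedTrail ℋ XH⁰ → ClosedTrail 𝒢 X
    trailH⁰⇒G c = trailH⇒G c (gH∉XH⁰ ∘ All.lookup (ClosedTrail.inX c))

    trailK⁰⇒G : ClosedTrail 𝒦 XK⁰ → ClosedTrail 𝒢 X
    trailK⁰⇒G c = trailK⇒G c (gK∉XK⁰ ∘ All.lookup (ClosedTrail.inX c))


    edgH∉edgK : ∀ is js {z} → z ∈ map edgH is → z ∉ map edgK js
    edgH∉edgK is js m₁ m₂ = let (i , _ , e₁) = ∈-map⁻ edgH m₁ ; (j , _ , e₂) = ∈-map⁻ edgK m₂ in edgH≢edgK (trans (sym e₁) e₂)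

    -- What is left of a cycle of H + g_H (resp. K + g_K) through g after deleting g.
    record PathH : Set where
      constructor pathH
      field
        {u w}  : Fin VH
        is     : List (Fin a)
        walk   : Walk ℋ u (map ιH is) w
        closes : Joins ℋ gH w u
        dist   : Distinct is
        inXH   : All (In XH) is

    record PathK : Set where
      constructor pathK
      field
        {x z}  : Fin VK
        js     : List (Fin b)
        walk   : Walk 𝒦 x (map ιK js) z
        closes : Joins 𝒦 gK z x
        dist   : Distinct js
        inXK   : All (In XK) js

    cutH : ClosedTrail ℋ XH¹ → ClosedTrail 𝒢 X ⊎ PathH
    cutH cH with gH ∈? ClosedTrail.edges cH
    ... | no gH∉ = inj₁ (trailH⇒G cH gH∉)
    ... | yes gH∈ with closedTrail-cut cH gH∈
    ...   | _ , _ , hs , W , closes , gH∉ , d , ax with unpunchIn gH hs gH∉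
    ...     | is , refl = inj₂ (pathH is W closes (distinct-map⁻ ιH d) (inιH⁻ true ax))

    cutK : ClosedTrail 𝒦 XK¹ → ClosedTrail 𝒢 X ⊎ PathK
    cutK cK with gK ∈? ClosedTrail.edges cK
    ... | no gK∉ = inj₁ (trailK⇒G cK gK∉)
    ... | yes gK∈ with closedTrail-cut cK gK∈
    ...   | _ , _ , ks , W , closes , gK∉ , d , ax with unpunchIn gK ks gK∉
    ...     | js , refl = inj₂ (pathK js W closes (distinct-map⁻ ιK d) (inιK⁻ true ax))

    pathK-nonempty : p ≢ q → (π : PathK) → PathK.js π ≢ []
    pathK-nonempty p≢q (pathK [] nil closes _ _) refl = p≢q (loop⇒ends≡ 𝒦 gK false closes)

    -- If s = t, both ends of a K-path are glued to the same vertex of G.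
    pathK⇒G : s ≡ t → p ≢ q → PathK → ClosedTrail 𝒢 X
    pathK⇒G s≡t p≢q π@(pathK js WK closes d ax) =
      closedTrail (map edgK js) (subst (Walk 𝒢 _ _) (sym x≡z) (walkK⇒G js WK))
        (map-≢[] (pathK-nonempty p≢q π)) (distinct-edgK d) (inK⁺ ax)
      where
      x≡z = oneOf-collapse (cong vtxH s≡t) (vtxK-end (proj₂ (gK-ends closes))) (vtxK-end (proj₁ (gK-ends closes)))

    -- If s ≠ t, an H-path and a K-path join the glued vertices s, t, in one of two orientations.
    paths⇒G : s ≢ t → p ≢ q → PathH → PathK → ClosedTrail 𝒢 X
    paths⇒G s≢t p≢q (pathH {u} {w} is WH closesH dH axH) πK@(pathK {x} {z} js WK closesK dK axK) =
      glue (vtxK x ≟ vtxH w)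
      where
      u≢w : vtxH u ≢ vtxH w
      u≢w e with vtxH-injective e
      ... | refl = s≢t (loop⇒ends≡ ℋ gH flip closesH)
      x≢z : vtxK x ≢ vtxK z
      x≢z e with vtxK-glued {x} {z} e
      ... | inj₁ refl           = p≢q (loop⇒ends≡ 𝒦 gK false closesK)
      ... | inj₂ (_ , _ , s≡t) = s≢t s≡t
      u∈ = vtxH-end (proj₂ (gH-ends closesH))
      w∈ = vtxH-end (proj₁ (gH-ends closesH))
      x∈ = vtxK-end (proj₂ (gK-ends closesK))
      z∈ = vtxK-end (proj₁ (gK-ends closesK))
      js≢[] = pathK-nonempty p≢q πK
      WGH = walkH⇒G is WH
      WGK = walkK⇒G js WK
      glue : Dec (vtxK x ≡ vtxH w) → ClosedTrail 𝒢 X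
      glue (yes x≡w) =
        closedTrail (map edgH is ++ map edgK js) (WGH ++ʷ subst₂ (λ v v′ → Walk 𝒢 v (map edgK js) v′) x≡w z≡u WGK)
          (λ e → map-≢[] js≢[] (proj₂ (++-≡[] (map edgH is) e)))
          (distinct-++ (distinct-edgH dH) (distinct-edgK dK) (edgH∉edgK is js))
          (++⁺ (inH⁺ axH) (inK⁺ axK))
        where
        z≡u = oneOf-third z∈ w∈ u∈ (λ z≡w → x≢z (trans x≡w (sym z≡w))) u≢w
      glue (no x≢w) =
        closedTrail (map edgH is ++ reverse (map edgK js))
          (WGH ++ʷ subst₂ (λ v v′ → Walk 𝒢 v (reverse (map edgK js)) v′) z≡w x≡u (reverseWalk WGK))
          (λ e → map-≢[] js≢[] (reverse-≡[] (proj₂ (++-≡[] (map edgH is) e))))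
          (distinct-++ (distinct-edgH dH) (distinct-reverse (distinct-edgK dK))
             (λ e∈H e∈K → edgH∉edgK is js e∈H (Any.reverse⁻ e∈K)))
          (++⁺ (inH⁺ axH) (All-reverse (inK⁺ axK)))
        where
        x≡u = oneOf-third x∈ w∈ u∈ x≢w u≢w
        z≡w = oneOf-third z∈ x∈ w∈ (x≢z ∘ sym) (λ w≡x → x≢w (sym w≡x))

    trailsH¹K¹⇒G : p ≢ q → ClosedTrail ℋ XH¹ → ClosedTrail 𝒦 XK¹ → ClosedTrail 𝒢 X
    trailsH¹K¹⇒G p≢q cH cK with cutK cK | s ≟ t
    ... | inj₁ cG | _       = cG
    ... | inj₂ πK | yes s≡t = pathK⇒G s≡t p≢q πK
    ... | inj₂ πK | no s≢t with cutH cH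
    ...   | inj₁ cG = cG
    ...   | inj₂ πH = paths⇒G s≢t p≢q πH πK

    -- The three ways a closed trail of G can arise, matching the three terms of G = H_g K^g + (H^g − H_g) K_g.
    data Split : Set where
      inH⁰   : ClosedTrail ℋ XH⁰ → Split
      inK⁰   : ClosedTrail 𝒦 XK⁰ → Split
      inH¹K¹ : ClosedTrail ℋ XH¹ → ClosedTrail 𝒦 XK¹ → Split

    -- A lift of a closed trail of K-edges either closes up in K, or its ends are the two ends of g_K
    -- glued to the single vertex s = t; then g_H is a loop.
    KClosing : Fin VK → Fin VK → Set
    KClosing x y = (y ≡ x) ⊎ (EndK x × EndK y × x ≢ y × s ≡ t)

    kClosing-vtx : ∀ {x y} → vtxK y ≡ vtxK x → KClosing x y
    kClosing-vtx {x} {y} y↦x with y ≟ x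
    ... | yes y≡x = inj₁ y≡x
    ... | no y≢x with vtxK-glued y↦x
    ...   | inj₁ y≡x               = ⊥-elim (y≢x y≡x)
    ...   | inj₂ (y∈ , x∈ , s≡t) = inj₂ (x∈ , y∈ , (y≢x ∘ sym) , s≡t)

    kClosing-ends : ∀ {x y} → EndK x → EndK y → s ≡ t → KClosing x y
    kClosing-ends {x} {y} x∈ y∈ s≡t with y ≟ x
    ... | yes y≡x = inj₁ y≡x
    ... | no y≢x  = inj₂ (x∈ , y∈ , (y≢x ∘ sym) , s≡t)

    splitK-closing : ∀ {x y} js → js ≢ [] → Walk 𝒦 x (map ιK js) y → Distinct js → All (In XK) js → KClosing x y → Split
    splitK-closing js js≢[] W d ax (inj₁ refl) = inK⁰ (trailK⁰ js js≢[] W d ax)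
    splitK-closing js js≢[] W d ax (inj₂ (x∈ , y∈ , x≢y , s≡t)) =
      inH¹K¹ (loop-trailH¹ s≡t) (trailK¹ js W (ends⇒joins 𝒦 gK false y∈ x∈ (x≢y ∘ sym)) d ax)

    splitK-glued : ∀ {v} ks → ks ≢ [] → Walk 𝒢 v (map edgK ks) v → Distinct ks → All (In XK) ks →
      ∀ {y} → EndK y → vtxK y ≡ v → s ≡ t → Split
    splitK-glued []       ks≢[] W d ax y∈ y↦v s≡t = ⊥-elim (ks≢[] refl)
    splitK-glued (k ∷ ks) ks≢[] W d ax {y} y∈ y↦v s≡t with liftWalkKFrom k ks W
    ... | x , x↦v , liftedFrom y′ y′↦v WK = splitK-closing (k ∷ ks) ks≢[] WK d ax (kClosing-vtx (trans y′↦v (sym x↦v)))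
    ... | x , x↦v , gluedFrom ks₁ ks₂ y′ _ ks≡ ks₁≢[] WK _ _ _ y′∈ _ =
      splitK-closing ks₁ ks₁≢[] WK (distinct-++ˡ ks₁ (subst Distinct ks≡ d)) (++⁻ˡ ks₁ (subst (All (In XK)) ks≡ ax))
        (kClosing-ends x∈ y′∈ s≡t)
      where
      x∈ : EndK x
      x∈ with vtxK-glued {x} {y} (trans x↦v (sym y↦v))
      ... | inj₁ refl          = y∈
      ... | inj₂ (x∈ , _ , _) = x∈

    splitK : ∀ {u} js → js ≢ [] → Walk 𝒢 u (map edgK js) u → Distinct js → All (In XK) js → Split
    splitK []       js≢[] W d ax = ⊥-elim (js≢[] refl)
    splitK (j ∷ js) js≢[] W d ax with liftWalkKFrom j js W
    ... | x , x↦u , liftedFrom y y↦u WK = splitK-closing (j ∷ js) js≢[] WK d ax (kClosing-vtx (trans y↦u (sym x↦u)))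
    ... | x , x↦u , gluedFrom js₁ js₂ y v js≡ js₁≢[] WK y↦v WG₁ WG₂ y∈ s≡t =
      splitK-glued (js₂ ++ js₁) (λ e → js₁≢[] (proj₂ (++-≡[] js₂ e)))
        (subst (λ es → Walk 𝒢 v es v) (sym (map-++ edgK js₂ js₁)) (WG₂ ++ʷ WG₁))
        (distinct-++-comm js₁ (subst Distinct js≡ d)) (++⁺ (++⁻ʳ js₁ ax′) (++⁻ˡ js₁ ax′)) y∈ y↦v s≡t
      where
      ax′ = subst (All (In XK)) js≡ ax

    splitH : ∀ {u} is → is ≢ [] → Walk 𝒢 u (map edgH is) u → Distinct is → All (In XH) is → Split
    splitH is is≢[] W d ax with startH is is≢[] W
    ... | x , x↦u with walkG⇒H is W x↦u
    ...   | y , y↦u , WH =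
      inH⁰ (trailH⁰ is is≢[] (subst (Walk ℋ x (map ιH is)) (vtxH-injective (trans y↦u (sym x↦u))) WH) d ax)

    -- A block of H-edges followed by a block of K-edges, starting on a K-vertex and ending on an H-vertex:
    -- both blocks run between s and t, so either one of them closes up or both close up through g.
    splitHK : p ≢ q → ∀ {v₁ v₂ v₃} is js → is ≢ [] → js ≢ [] →
      Walk 𝒢 v₁ (map edgH is) v₂ → Walk 𝒢 v₂ (map edgK js) v₃ →
      Σ[ z₁ ∈ Fin VK ] (vtxK z₁ ≡ v₁) → Σ[ x₃ ∈ Fin VH ] (vtxH x₃ ≡ v₃) →
      Distinct is → All (In XH) is → Distinct js → All (In XK) js → Split
    splitHK p≢q is js is≢[] js≢[] WGH WGK (z₁ , z₁↦v₁) (x₃ , x₃↦v₃) dH axH dK axK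
      with startH is is≢[] WGH
    ... | x₁ , x₁↦v₁ with walkG⇒H is WGH x₁↦v₁ | startK js js≢[] WGK
    ... | y₂ , y₂↦v₂ , WH | z₂ , z₂↦v₂
      with vtxK≡vtxH {z₁} (trans z₁↦v₁ (sym x₁↦v₁)) | vtxK≡vtxH {z₂} (trans z₂↦v₂ (sym y₂↦v₂))
    ... | _ , x₁∈ | z₂∈ , y₂∈ with x₁ ≟ y₂
    ... | yes refl = inH⁰ (trailH⁰ is is≢[] WH dH axH)
    ... | no x₁≢y₂ with liftWalkK js WGK z₂↦v₂
    ...   | glued _ _ _ _ _ _ _ _ _ _ s≡t = ⊥-elim (x₁≢y₂ (oneOf-collapse s≡t x₁∈ y₂∈))
    ...   | lifted y₃ y₃↦v₃ WK with y₃ ≟ z₂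
    ...     | yes refl  = inK⁰ (trailK⁰ js js≢[] WK dK axK)
    ...     | no y₃≢z₂ = inH¹K¹ (trailH¹ is WH (ends⇒joins ℋ gH flip y₂∈ x₁∈ (x₁≢y₂ ∘ sym)) dH axH)
                                  (trailK¹ js WK (ends⇒joins 𝒦 gK false y₃∈ z₂∈ y₃≢z₂) dK axK)
      where y₃∈ = proj₁ (vtxK≡vtxH {y₃} (trans y₃↦v₃ (sym x₃↦v₃)))

    splitBlocks : p ≢ q → ∀ {u} is js → Walk 𝒢 u (map edgH is ++ map edgK js) u → map edgH is ++ map edgK js ≢ [] →
      Distinct (map edgH is ++ map edgK js) → All (In X) (map edgH is ++ map edgK js) → Split
    splitBlocks p≢q {u} is [] W hs≢[] d ax =
      splitH is (λ e → hs≢[] (trans (++-identityʳ (map edgH is)) (cong (map edgH) e)))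
        (subst (λ es → Walk 𝒢 u es u) (++-identityʳ (map edgH is)) W)
        (distinct-map⁻ edgH (subst Distinct (++-identityʳ (map edgH is)) d))
        (inH⁻ (subst (All (In X)) (++-identityʳ (map edgH is)) ax))
    splitBlocks p≢q [] (j ∷ js) W hs≢[] d ax = splitK (j ∷ js) (λ ()) W (distinct-map⁻ edgK d) (inK⁻ ax)
    splitBlocks p≢q (i ∷ is) (j ∷ js) W hs≢[] d ax with splitWalk (map edgH (i ∷ is)) W
    ... | _ , WGH , WGK =
      splitHK p≢q (i ∷ is) (j ∷ js) (λ ()) (λ ()) WGH WGK (endK (j ∷ js) (λ ()) WGK) (startH (i ∷ is) (λ ()) WGH)
        (distinct-map⁻ edgH (distinct-++ˡ (map edgH (i ∷ is)) d)) (inH⁻ (++⁻ˡ (map edgH (i ∷ is)) ax))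
        (distinct-map⁻ edgK (distinct-++ʳ (map edgH (i ∷ is)) d)) (inK⁻ (++⁻ʳ (map edgH (i ∷ is)) ax))

    splitFromKH : p ≢ q → ∀ {v} i zs j₀ → Walk 𝒢 v (edgH i ∷ zs ++ [ edgK j₀ ]) v → Σ[ z ∈ Fin VK ] (vtxK z ≡ v) →
      Distinct (edgH i ∷ zs ++ [ edgK j₀ ]) → All (In X) (edgH i ∷ zs ++ [ edgK j₀ ]) → Split
    splitFromKH p≢q {v} i zs j₀ W z↦v d ax with spanHK zs j₀
    ... | is , j , js , rest , span , starts-in-H
      with splitWalk (map edgH (i ∷ is)) (subst (λ es → Walk 𝒢 v es v) (cong (edgH i ∷_) span) W)
    ... | _ , WGH , W-K-rest with splitWalk (map edgK (j ∷ js)) W-K-rest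
    ... | _ , WGK , W-rest =
      splitHK p≢q (i ∷ is) (j ∷ js) (λ ()) (λ ()) WGH WGK z↦v
        (startsInH-vtx rest starts-in-H W-rest (proj₂ (startH (i ∷ is) (λ ()) WGH)))
        (distinct-map⁻ edgH (distinct-++ˡ (map edgH (i ∷ is)) d′)) (inH⁻ (++⁻ˡ (map edgH (i ∷ is)) ax′))
        (distinct-map⁻ edgK (distinct-++ˡ (map edgK (j ∷ js)) (distinct-++ʳ (map edgH (i ∷ is)) d′)))
        (inK⁻ (++⁻ˡ (map edgK (j ∷ js)) (++⁻ʳ (map edgH (i ∷ is)) ax′)))
      where
      d′ = subst Distinct (cong (edgH i ∷_) span) d
      ax′ = subst (All (In X)) (cong (edgH i ∷_) span) ax

    splitAtKH : p ≢ q → ∀ {u} l₁ j₀ i₁ l₂ → Walk 𝒢 u ((l₁ ++ [ edgK j₀ ]) ++ (edgH i₁ ∷ l₂)) u →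
      Distinct ((l₁ ++ [ edgK j₀ ]) ++ (edgH i₁ ∷ l₂)) → All (In X) ((l₁ ++ [ edgK j₀ ]) ++ (edgH i₁ ∷ l₂)) → Split
    splitAtKH p≢q l₁ j₀ i₁ l₂ W d ax =
      splitFromKH p≢q i₁ (l₂ ++ l₁) j₀ (subst (λ es → Walk 𝒢 v es v) rotated≡ (W₂ ++ʷ W₁))
        (endK [ j₀ ] (λ ()) (proj₂ (proj₂ (splitWalk l₁ W₁))))
        (subst Distinct rotated≡ (distinct-++-comm (l₁ ++ [ edgK j₀ ]) d))
        (subst (All (In X)) rotated≡ (++⁺ (++⁻ʳ (l₁ ++ [ edgK j₀ ]) ax) (++⁻ˡ (l₁ ++ [ edgK j₀ ]) ax)))
      where
      split = splitWalk (l₁ ++ [ edgK j₀ ]) W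
      v  = proj₁ split
      W₁ = proj₁ (proj₂ split)
      W₂ = proj₂ (proj₂ split)
      rotated≡ : (edgH i₁ ∷ l₂) ++ (l₁ ++ [ edgK j₀ ]) ≡ edgH i₁ ∷ (l₂ ++ l₁) ++ [ edgK j₀ ]
      rotated≡ = cong (edgH i₁ ∷_) (sym (++-assoc l₂ l₁ [ edgK j₀ ]))

    trailG⇒split : p ≢ q → ClosedTrail 𝒢 X → Split
    trailG⇒split p≢q (closedTrail {u} hs W hs≢[] d ax) with findKH hs
    ... | inj₂ (is , js , hs≡) =
      splitBlocks p≢q is js (subst (λ es → Walk 𝒢 u es u) hs≡ W) (λ e → hs≢[] (trans hs≡ e))
        (subst Distinct hs≡ d) (subst (All (In X)) hs≡ ax)
    ... | inj₁ (l₁ , j₀ , i₁ , l₂ , hs≡) =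
      splitAtKH p≢q l₁ j₀ i₁ l₂ (subst (λ es → Walk 𝒢 u es u) hs≡′ W)
        (subst Distinct hs≡′ d) (subst (All (In X)) hs≡′ ax)
      where hs≡′ = trans hs≡ (sym (++-assoc l₁ [ edgK j₀ ] (edgH i₁ ∷ l₂)))

    acyclic-twoSum⇔ : p ≢ q → Dec (Acyclic ℋ XH¹) →
      Acyclic 𝒢 X ⇔ (Acyclic ℋ XH⁰ × Acyclic 𝒦 XK⁰ × (Acyclic ℋ XH¹ ⊎ Acyclic 𝒦 XK¹))
    acyclic-twoSum⇔ p≢q H¹? = mk⇔ to from
      where
      to : Acyclic 𝒢 X → Acyclic ℋ XH⁰ × Acyclic 𝒦 XK⁰ × (Acyclic ℋ XH¹ ⊎ Acyclic 𝒦 XK¹)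
      to acyclic = (λ cH → acyclic (closedTrail⇒cycle (trailH⁰⇒G (cycle⇒closedTrail cH))))
                 , (λ cK → acyclic (closedTrail⇒cycle (trailK⁰⇒G (cycle⇒closedTrail cK))))
                 , H¹-or-K¹ H¹?
        where
        H¹-or-K¹ : Dec (Acyclic ℋ XH¹) → Acyclic ℋ XH¹ ⊎ Acyclic 𝒦 XK¹
        H¹-or-K¹ (yes H¹-acyclic) = inj₁ H¹-acyclic
        H¹-or-K¹ (no  H¹-cyclic)  = inj₂ (λ cK → H¹-cyclic (λ cH → acyclic (closedTrail⇒cycle
                                      (trailsH¹K¹⇒G p≢q (cycle⇒closedTrail cH) (cycle⇒closedTrail cK)))))
      from : Acyclic ℋ XH⁰ × Acyclic 𝒦 XK⁰ × (Acyclic ℋ XH¹ ⊎ Acyclic 𝒦 XK¹) → Acyclic 𝒢 X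
      from (H⁰-acyclic , K⁰-acyclic , H¹-or-K¹) cG with trailG⇒split p≢q (cycle⇒closedTrail cG)
      ... | inH⁰ cH      = H⁰-acyclic (closedTrail⇒cycle cH)
      ... | inK⁰ cK      = K⁰-acyclic (closedTrail⇒cycle cK)
      ... | inH¹K¹ cH cK = [ (λ H¹-acyclic → H¹-acyclic (closedTrail⇒cycle cH))
                           , (λ K¹-acyclic → K¹-acyclic (closedTrail⇒cycle cK)) ]′ H¹-or-K¹

  sfp-twoSum : (decG : ∀ X → Dec (Acyclic 𝒢 X)) (decH : ∀ X → Dec (Acyclic ℋ X)) (decK : ∀ X → Dec (Acyclic 𝒦 X)) →
    p ≢ q → IsTwoSumProduct (sfp ℋ decH) gH (sfp 𝒦 decK) gK (sfp 𝒢 decG)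
  sfp-twoSum decG decH decK p≢q XH XK
    rewrite sfp-indicator 𝒢 decG (XH ++ᵥ XK)
          | sfp-indicator ℋ decH (insertAtᵥ XH gH false) | sfp-indicator ℋ decH (insertAtᵥ XH gH true)
          | sfp-indicator 𝒦 decK (insertAtᵥ XK gK false) | sfp-indicator 𝒦 decK (insertAtᵥ XK gK true)
    = trans (indicator-⇔ (Cycles.acyclic-twoSum⇔ XH XK p≢q (decH XH¹)) (decG (XH ++ᵥ XK))
                         (decH XH⁰ ×-dec decK XK⁰ ×-dec (decH XH¹ ⊎-dec decK XK¹)))
            (indicator-twoSum (Acyclic-insertAt ℋ XH gH) (Acyclic-insertAt 𝒦 XK gK)
                              (decH XH⁰) (decH XH¹) (decK XK⁰) (decK XK¹))
    where open Cycles XH XK using (XH⁰; XH¹; XK⁰; XK¹)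

q*[p÷q-1]≡p-q : ∀ p q .{{_ : NonZero q}} → q * (p ÷ q - 1ℚ) ≡ p - q
q*[p÷q-1]≡p-q p q = begin
  q * (p * (1/ q) - 1ℚ)  ≡⟨ solve 3 (λ q p q⁻¹ → q :* (p :* q⁻¹ :- con 1ℚ) := p :* (q :* q⁻¹) :- q) refl q p (1/ q) ⟩
  p * (q * (1/ q)) - q   ≡⟨ cong (λ r → p * r - q) (*-inverseʳ q) ⟩
  p * 1ℚ - q             ≡⟨ cong (_- q) (*-identityʳ p) ⟩
  p - q                  ∎
  where open ≡-Reasoning

Φ-twoSum : ∀ {a b} (ℋ : Graph (suc a)) (gH : Fin (suc a)) (𝒦 : Graph (suc b)) (gK : Fin (suc b)) (flip : Bool)
  (decG : ∀ X → Dec (Acyclic (twoSum ℋ gH 𝒦 gK flip) X))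
  (decH : ∀ X → Dec (Acyclic ℋ X)) (decK : ∀ X → Dec (Acyclic 𝒦 X))
  (e : Fin a) (y : Fin (a +ℕ b) → ℚ) →
  let G = sfp (twoSum ℋ gH 𝒦 gK flip) decG
      H = sfp ℋ decH
      K = sfp 𝒦 decK
      yK = insertAt (λ j → y (a ↑ʳ j)) gK 0ℚ
      Kg = eval (∂ gK K) yK
      K⁰ = eval (at0 gK K) yK
  in (nz : Kg ≢ 0ℚ) →
  Φ (e ↑ˡ b) G y ≡ (Kg * Kg) * Φ (punchIn gH e) H (insertAt (λ i → y (i ↑ˡ b)) gH ((_÷_ K⁰ Kg {{≢-nonZero nz}}) - 1ℚ))
Φ-twoSum {a} {b} ℋ gH 𝒦 gK flip decG decH decK e y Kg≢0 =
  trans (Φ-twoSumProduct {H = sfp ℋ decH} {gH} {K} {gK} {sfp (twoSum ℋ gH 𝒦 gK flip) decG}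
          (sfp-twoSum ℋ gH 𝒦 gK flip decG decH decK gK-not-loop) e y c Kg*c≡K⁰-Kg)
        (cong (λ k → (k * k) * Φ (punchIn gH e) (sfp ℋ decH) (insertAt (λ i → y (i ↑ˡ b)) gH c)) (sym Kg≡))
  where
  K = sfp 𝒦 decK
  yK = λ j → y (a ↑ʳ j)
  Kg≡ : eval (∂ gK K) (insertAt yK gK 0ℚ) ≡ eval (slice gK true K) yK
  Kg≡ = eval-∂-insertAt K gK yK 0ℚ
  K⁰≡ : eval (at0 gK K) (insertAt yK gK 0ℚ) ≡ eval (slice gK false K) yK
  K⁰≡ = eval-at0-insertAt K gK yK 0ℚ
  instance _ = ≢-nonZero Kg≢0
  c = eval (at0 gK K) (insertAt yK gK 0ℚ) ÷ eval (∂ gK K) (insertAt yK gK 0ℚ) - 1ℚ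
  Kg*c≡K⁰-Kg : eval (slice gK true K) yK * c ≡ eval (slice gK false K) yK - eval (slice gK true K) yK
  Kg*c≡K⁰-Kg = subst₂ (λ k k⁰ → k * c ≡ k⁰ - k) Kg≡ K⁰≡
    (q*[p÷q-1]≡p-q (eval (at0 gK K) (insertAt yK gK 0ℚ)) (eval (∂ gK K) (insertAt yK gK 0ℚ)))
  gK-not-loop : proj₁ (ends 𝒦 gK) ≢ proj₂ (ends 𝒦 gK)
  gK-not-loop loop = Kg≢0 (trans (eval-cong (insertAt yK gK 0ℚ) (∂-sfp-loop 𝒦 decK loop)) (eval-zero (insertAt yK gK 0ℚ)))

lemma3p2 :
  (∀ {m} (𝒢 : Graph m) (decG : ∀ X → Dec (Acyclic 𝒢 X)) (e f : Fin m) → e ≢ f →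
     ∀ (y : Fin m → ℚ) →
       let G = sfp 𝒢 decG in
       Φ e G y ≡ (Φ e (at0 f G) y + y f * Ψ e f G y) + (y f * y f) * Φ e (∂ f G) y)
  ×
  (∀ {a b} (ℋ : Graph (suc a)) (gH : Fin (suc a)) (𝒦 : Graph (suc b)) (gK : Fin (suc b))
     (flip : Bool)
     (decG : ∀ X → Dec (Acyclic (twoSum ℋ gH 𝒦 gK flip) X))
     (decH : ∀ X → Dec (Acyclic ℋ X))
     (decK : ∀ X → Dec (Acyclic 𝒦 X))
     (e : Fin a) (y : Fin (a +ℕ b) → ℚ) →
       let G = sfp (twoSum ℋ gH 𝒦 gK flip) decG
           H = sfp ℋ decH
           K = sfp 𝒦 decK
           yK = insertAt (λ j → y (a ↑ʳ j)) gK 0ℚ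
           Kg = eval (∂ gK K) yK
           K⁰ = eval (at0 gK K) yK
       in (nz : Kg ≢ 0ℚ) →
       Φ (e ↑ˡ b) G y
         ≡ (Kg * Kg) * Φ (punchIn gH e)
                          H (insertAt (λ i → y (i ↑ˡ b)) gH ((_÷_ K⁰ Kg {{≢-nonZero nz}}) - 1ℚ)))
lemma3p2 = (λ 𝒢 decG e f e≢f y → Φ-expand (sfp 𝒢 decG) e≢f y) , Φ-twoSum
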